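{- Let $Q^+(7,2)$ be a non-degenerate hyperbolic quadric of ${\rm PG}(7,2)$ with fixed generator $\Pi$, and let $\mathcal G_3$ be the graph with vertex set $Q^+(7,2)\setminus\Pi$ where distinct vertices $P_1,P_2$ are adjacent iff $P_1\sim_1P_2$ (the line $\langle P_1,P_2\rangle$ is secant to $Q^+(7,2)$) or $P_1\sim_2 P_2$ (the line $\langle P_1,P_2\rangle$ is contained in $Q^+(7,2)$ and meets $\Pi$ in a point). Let $\mathcal C=\{P,Q,R\}$ be a clique of mixed type in $\mathcal G_3$, and let $T$ be a vertex not in the plane $\langle P,Q,R\rangle$ such that $T$ is in relation $\sim_1$ with each of $P,Q,R$. Then $\gamma=\langle P,Q,R,T\rangle$ is a solid and $\gamma\cap Q^+(7,2)=SQ(2,2)$, a cone with vertex a point $S\in\Pi$ and base a conic $Q(2,2)$ not meeting $\Pi$; moreover there is exactly one maximal clique of $\mathcal G_3$ containing $\{P,Q,R,T\}$, it has size $8$, and it is the set of vertices of $\mathcal G_3$ in a cone $SQ^-(3,2)$ (the intersection of $Q^+(7,2)$ with a $4$-space, a cone with vertex $S$ over an elliptic quadric $Q^-(3,2)$) that meets $\Pi$ in a line.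
   Context: A generator of $Q^+(7,2)$ is a solid contained in the quadric. A clique is of mixed type if it contains both a pair in relation $\sim_1$ and a pair in relation $\sim_2$. -}

module Defs where

open import Data.Bool using (Bool; true; false; _xor_; if_then_else_)
open import Data.Nat using (ℕ; zero; suc; _+_)
open import Data.List using (List; []; _∷_; _++_; map)
open import Data.Nat.ListAction using (sum)
open import Data.Vec using (Vec; []; _∷_; replicate; zipWith)
open import Data.Product using (Σ; _×_; _,_; ∃)
open import Data.Sum using (_⊎_)
open import Data.Empty using (⊥)
open import Data.Unit using (⊤)
open import Relation.Nullary using (¬_)
open import Relation.Binary.PropositionalEquality using (_≡_; _≢_)

-- The vector space V = GF(2)^8 underlying PG(7,2).
-- GF(2) is Bool with xor as addition (true = 1).
-- A projective point of PG(7,2) is a nonzero vector (over GF(2) every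
-- projective point has exactly one nonzero representative).

V : Set
V = Vec Bool 8

0v : V
0v = replicate 8 false

infixl 6 _⊕_
_⊕_ : V → V → V
_⊕_ = zipWith _xor_

lincomb : ∀ {k} → Vec Bool k → Vec V k → V
lincomb []       []       = 0v
lincomb (c ∷ cs) (v ∷ vs) = (if c then v else 0v) ⊕ lincomb cs vs

InSpan : ∀ {k} → Vec V k → V → Set
InSpan vs x = ∃ λ cs → lincomb cs vs ≡ x

-- vs linearly independent (so ⟨vs⟩ has projective dimension k - 1)
Independent : ∀ {k} → Vec V k → Set
Independent {k} vs = ∀ cs → lincomb cs vs ≡ 0v → cs ≡ replicate k false

PointOf : ∀ {k} → Vec V k → V → Set
PointOf vs x = x ≢ 0v × InSpan vs x

polar : (V → Bool) → V → V → Bool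
polar q x y = q (x ⊕ y) xor q x xor q y

-- Over GF(2), q is a quadratic form iff q(0) = 0 and its polar form is
-- bilinear (additive in the first argument; symmetry is automatic).
IsQuadForm : (V → Bool) → Set
IsQuadForm q = (q 0v ≡ false)
             × (∀ x y z → polar q (x ⊕ y) z ≡ (polar q x z xor polar q y z))

-- x is a singular vector (the point x lies on the quadric)
Sing : (V → Bool) → V → Set
Sing q x = q x ≡ false

NonsingularOn : (V → Bool) → (V → Set) → Set
NonsingularOn q W =
  ∀ v → W v → v ≢ 0v → Sing q v → (∀ w → W w → polar q v w ≡ false) → ⊥

Nonsingular : (V → Bool) → Set
Nonsingular q = NonsingularOn q (λ _ → ⊤)

-- A generator of the quadric: a solid (projective 3-space, vector dim 4)
-- contained in the quadric.  Given by a basis g.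
Generator : (V → Bool) → Vec V 4 → Set
Generator q g = Independent g × (∀ x → InSpan g x → Sing q x)

module _ (q : V → Bool) (g : Vec V 4) where

  Vertex : V → Set
  Vertex x = x ≢ 0v × Sing q x × ¬ InSpan g x

  Rel1 : V → V → Set
  Rel1 a b = Σ V λ x → Σ V λ y → x ≢ y
           × PointOf (a ∷ b ∷ []) x × Sing q x
           × PointOf (a ∷ b ∷ []) y × Sing q y
           × (∀ z → PointOf (a ∷ b ∷ []) z → Sing q z → z ≡ x ⊎ z ≡ y)

  Rel2 : V → V → Set
  Rel2 a b = (∀ z → PointOf (a ∷ b ∷ []) z → Sing q z)
           × (Σ V λ x → PointOf (a ∷ b ∷ []) x × InSpan g x
               × (∀ y → PointOf (a ∷ b ∷ []) y → InSpan g y → y ≡ x))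

  Adj : V → V → Set
  Adj a b = Vertex a × Vertex b × a ≢ b × (Rel1 a b ⊎ Rel2 a b)

  Clique : (V → Bool) → Set
  Clique K = (∀ x → K x ≡ true → Vertex x)
           × (∀ x y → K x ≡ true → K y ≡ true → x ≢ y → Adj x y)

  MaximalClique : (V → Bool) → Set
  MaximalClique K = Clique K
    × (∀ K′ → Clique K′ → (∀ x → K x ≡ true → K′ x ≡ true)
            → ∀ x → K′ x ≡ true → K x ≡ true)

  Clique3 : V → V → V → Set
  Clique3 a b c = Adj a b × Adj a c × Adj b c

  MixedType : V → V → V → Set
  MixedType a b c = (Rel1 a b ⊎ Rel1 a c ⊎ Rel1 b c)
                  × (Rel2 a b ⊎ Rel2 a c ⊎ Rel2 b c)

OnCone : ∀ {k} → (V → Bool) → V → Vec V k → V → Set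
OnCone q S base x = x ≡ S
  ⊎ (Σ V λ c → PointOf base c × Sing q c × (x ≡ c ⊎ x ≡ S ⊕ c))

IsCone : ∀ {k} → (V → Bool) → V → Vec V k → Set
IsCone q S base = Independent (S ∷ base)
  × (∀ x → PointOf (S ∷ base) x → Sing q x → OnCone q S base x)
  × (∀ x → PointOf (S ∷ base) x → OnCone q S base x → Sing q x)

NondegConic : (V → Bool) → Vec V 3 → Set
NondegConic q b = Independent b × NonsingularOn q (InSpan b)

Elliptic : (V → Bool) → Vec V 4 → Set
Elliptic q b = Independent b × NonsingularOn q (InSpan b)
  × (∀ u v → InSpan b u → InSpan b v → Independent (u ∷ v ∷ [])
       → ¬ (Sing q u × Sing q v × Sing q (u ⊕ v)))

SubSpan : ∀ {k l} → Vec V k → Vec V l → Set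
SubSpan A B = ∀ x → InSpan A x → InSpan B x

allVec : (n : ℕ) → List (Vec Bool n)
allVec zero    = [] ∷ []
allVec (suc n) = map (false ∷_) (allVec n) ++ map (true ∷_) (allVec n)

card : (V → Bool) → ℕ
card K = sum (map (λ x → if K x then 1 else 0) (allVec 8))

{-# OPTIONS --safe #-}
-- After relabelling the mixed triangle P, Q, R as A, B, C with A ∼₂ B, the point S = A ⊕ B lies in Π
-- and C, T are secant to all the other points. A generator of a nonsingular quadric of PG(7,2) is its
-- own polar space, and no point of the plane ⟨A, C, T⟩ lies in Π, so Π contains W₁, W₂, W₃ dual to
-- A, C, T. The frame (A, C, T, S, W₁, W₂, W₃) spans S⊥, which contains every vertex joined to both A
-- and B, and in its coordinates the quadratic form is q₇ = ac + at + ct + aw₁ + cw₂ + tw₃, with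
-- radical S. Every claim of the theorem thus becomes a statement about q₇ on GF(2)⁷, decided by
-- exhaustive evaluation and transported back along the frame.
module Submission where

open import Defs
open import Data.Bool using (Bool; true; false; _xor_; _∧_; _∨_; if_then_else_)
import Data.Bool as Bool
open import Data.Bool.Properties
  using (xor-comm; xor-assoc; xor-same; xor-identityʳ; ∧-comm; ∧-zeroʳ; ∧-identityʳ; ¬-not; ⇔→≡)
open import Data.Empty using (⊥; ⊥-elim)
open import Data.Fin using (Fin; zero; suc; _<_)
open import Data.Fin.Patterns using (0F; 1F; 2F; 3F; 4F; 5F; 6F)
open import Data.Fin.Properties using (pigeonhole; 2↔Bool; *↔×; <⇒≢)
open import Data.List using (List; []; _∷_; length)
import Data.List as List
open import Data.List.Membership.Propositional using (_∈_; lose)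
open import Data.List.Membership.Propositional.Properties using (∈-map⁺; ∈-map⁻; ∈-++⁺ˡ; ∈-++⁺ʳ)
import Data.List.Membership.DecPropositional
open import Data.List.Properties using (map-++)
import Data.List.Relation.Unary.All as ListAll
open import Data.List.Relation.Unary.All.Properties using (All¬⇒¬Any)
open import Data.List.Relation.Unary.Any as Any using (here; there)
open import Data.List.Relation.Unary.Unique.Propositional using (Unique; []; _∷_)
open import Data.List.Relation.Unary.Unique.Propositional.Properties using () renaming (map⁺ to Unique-map⁺)
open import Data.Nat using (ℕ; zero; suc; _+_; _^_; s≤s; z≤n)
open import Data.Nat.ListAction using (sum)
open import Data.Nat.ListAction.Properties using (sum-++)
open import Data.Nat.Properties using (^-monoʳ-<; +-suc; n<1+n)
open import Data.Product using (Σ; _×_; _,_; ∃; ∃₂; proj₁; proj₂; uncurry)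
open import Data.Product.Function.NonDependent.Propositional using (_×-↔_)
open import Data.Sum using (_⊎_; inj₁; inj₂; [_,_]′)
open import Data.Unit using (⊤; tt)
open import Data.Vec using (Vec; []; _∷_; replicate; zipWith; map; lookup; _++_; splitAt)
import Data.Vec.Properties as Vec
open import Data.Vec.Properties using (zipWith-assoc; zipWith-comm; zipWith-identityˡ; zipWith-identityʳ; map-∘; map-cong)
open import Data.Vec.Relation.Unary.All using (All; []; _∷_)
import Data.Vec.Relation.Unary.All as VecAll
open import Data.Vec.Relation.Unary.All.Properties using (map⁺)
open import Function using (_∘_; flip)
open import Function.Bundles using (_↔_; mk↔ₛ′; Inverse; mk⇔)
open import Function.Properties.Inverse using (↔-sym; ↔-trans)
open import Relation.Binary.Definitions using (DecidableEquality)
open import Relation.Binary.PropositionalEquality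
open import Relation.Nullary using (Dec; does; yes; no; ¬_; ¬?; contradiction)
open import Relation.Nullary.Decidable
  using (map′; from-yes; decidable-stable; dec-true; dec-false; _×-dec_; _⊎-dec_; _→-dec_)
open import Relation.Unary using (Decidable)

private variable
  k l n : ℕ

infixl 6 _∔_
infixr 7 _·_

_∔_ : Vec Bool n → Vec Bool n → Vec Bool n
_∔_ = zipWith _xor_

zeros : Vec Bool n
zeros = replicate _ false

_·_ : Bool → Vec Bool n → Vec Bool n
c · x = if c then x else zeros

∔-comm : (x y : Vec Bool n) → x ∔ y ≡ y ∔ x
∔-comm = zipWith-comm xor-comm

∔-assoc : (x y z : Vec Bool n) → x ∔ y ∔ z ≡ x ∔ (y ∔ z)
∔-assoc = zipWith-assoc xor-assoc

∔-identityˡ : (x : Vec Bool n) → zeros ∔ x ≡ x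
∔-identityˡ = zipWith-identityˡ (λ _ → refl)

∔-identityʳ : (x : Vec Bool n) → x ∔ zeros ≡ x
∔-identityʳ = zipWith-identityʳ xor-identityʳ

∔-self : (x : Vec Bool n) → x ∔ x ≡ zeros
∔-self []      = refl
∔-self (a ∷ x) = cong₂ _∷_ (xor-same a) (∔-self x)

∔-cancelˡ : (x y : Vec Bool n) → x ∔ (x ∔ y) ≡ y
∔-cancelˡ x y = begin
  x ∔ (x ∔ y)  ≡⟨ ∔-assoc x x y ⟨
  x ∔ x ∔ y    ≡⟨ cong (_∔ y) (∔-self x) ⟩
  zeros ∔ y    ≡⟨ ∔-identityˡ y ⟩
  y            ∎
  where open ≡-Reasoning

∔-cancelʳ : (x y : Vec Bool n) → x ∔ y ∔ y ≡ x
∔-cancelʳ x y = begin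
  x ∔ y ∔ y    ≡⟨ ∔-assoc x y y ⟩
  x ∔ (y ∔ y)  ≡⟨ cong (x ∔_) (∔-self y) ⟩
  x ∔ zeros    ≡⟨ ∔-identityʳ x ⟩
  x            ∎
  where open ≡-Reasoning

∔≡zeros⇒≡ : (x y : Vec Bool n) → x ∔ y ≡ zeros → x ≡ y
∔≡zeros⇒≡ x y e = begin
  x                ≡⟨ ∔-identityʳ x ⟨
  x ∔ zeros        ≡⟨ cong (x ∔_) e ⟨
  x ∔ (x ∔ y)      ≡⟨ ∔-cancelˡ x y ⟩
  y                ∎
  where open ≡-Reasoning

∔-left-comm : (a b c : Vec Bool n) → a ∔ (b ∔ c) ≡ b ∔ (a ∔ c)
∔-left-comm a b c = begin
  a ∔ (b ∔ c)  ≡⟨ ∔-assoc a b c ⟨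
  a ∔ b ∔ c    ≡⟨ cong (_∔ c) (∔-comm a b) ⟩
  b ∔ a ∔ c    ≡⟨ ∔-assoc b a c ⟩
  b ∔ (a ∔ c)  ∎
  where open ≡-Reasoning

∔-interchange : (a b c d : Vec Bool n) → (a ∔ b) ∔ (c ∔ d) ≡ (a ∔ c) ∔ (b ∔ d)
∔-interchange a b c d = begin
  a ∔ b ∔ (c ∔ d)    ≡⟨ ∔-assoc a b (c ∔ d) ⟩
  a ∔ (b ∔ (c ∔ d))  ≡⟨ cong (a ∔_) (∔-assoc b c d) ⟨
  a ∔ (b ∔ c ∔ d)    ≡⟨ cong (λ u → a ∔ (u ∔ d)) (∔-comm b c) ⟩
  a ∔ (c ∔ b ∔ d)    ≡⟨ cong (a ∔_) (∔-assoc c b d) ⟩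
  a ∔ (c ∔ (b ∔ d))  ≡⟨ ∔-assoc a c (b ∔ d) ⟨
  a ∔ c ∔ (b ∔ d)    ∎
  where open ≡-Reasoning

·-distribʳ-xor : (c d : Bool) (x : Vec Bool n) → (c xor d) · x ≡ c · x ∔ d · x
·-distribʳ-xor true  true  x = sym (∔-self x)
·-distribʳ-xor true  false x = sym (∔-identityʳ x)
·-distribʳ-xor false d     x = sym (∔-identityˡ (d · x))

comb : Vec Bool k → Vec (Vec Bool n) k → Vec Bool n
comb []       []       = zeros
comb (c ∷ cs) (v ∷ vs) = c · v ∔ comb cs vs

lincomb≡comb : (cs : Vec Bool k) (vs : Vec V k) → lincomb cs vs ≡ comb cs vs
lincomb≡comb []       []       = refl
lincomb≡comb (c ∷ cs) (v ∷ vs) = cong (c · v ∔_) (lincomb≡comb cs vs)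

comb-zeros : (vs : Vec (Vec Bool n) k) → comb zeros vs ≡ zeros
comb-zeros []       = refl
comb-zeros (v ∷ vs) = trans (∔-identityˡ _) (comb-zeros vs)

comb-∔ : (c d : Vec Bool k) (vs : Vec (Vec Bool n) k) → comb (c ∔ d) vs ≡ comb c vs ∔ comb d vs
comb-∔ []       []       []       = sym (∔-identityˡ zeros)
comb-∔ (c ∷ cs) (d ∷ ds) (v ∷ vs) = begin
  (c xor d) · v ∔ comb (cs ∔ ds) vs          ≡⟨ cong₂ _∔_ (·-distribʳ-xor c d v) (comb-∔ cs ds vs) ⟩
  (c · v ∔ d · v) ∔ (comb cs vs ∔ comb ds vs) ≡⟨ ∔-interchange (c · v) (d · v) _ _ ⟩
  (c · v ∔ comb cs vs) ∔ (d · v ∔ comb ds vs) ∎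
  where open ≡-Reasoning

comb-· : (c : Bool) (d : Vec Bool k) (vs : Vec (Vec Bool n) k) → comb (c · d) vs ≡ c · comb d vs
comb-· true  d vs = refl
comb-· false d vs = comb-zeros vs

comb-map : (c : Vec Bool k) (ds : Vec (Vec Bool l) k) (bs : Vec (Vec Bool n) l) →
           comb c (map (λ d → comb d bs) ds) ≡ comb (comb c ds) bs
comb-map []       []       bs = sym (comb-zeros bs)
comb-map (c ∷ cs) (d ∷ ds) bs = begin
  c · comb d bs ∔ comb cs (map (λ d → comb d bs) ds) ≡⟨ cong₂ _∔_ (sym (comb-· c d bs)) (comb-map cs ds bs) ⟩
  comb (c · d) bs ∔ comb (comb cs ds) bs             ≡⟨ comb-∔ (c · d) (comb cs ds) bs ⟨
  comb (c · d ∔ comb cs ds) bs                       ∎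
  where open ≡-Reasoning

comb-++ : (c : Vec Bool k) (d : Vec Bool l) (xs : Vec (Vec Bool n) k) (ys : Vec (Vec Bool n) l) →
          comb (c ++ d) (xs ++ ys) ≡ comb c xs ∔ comb d ys
comb-++ []       d []       ys = sym (∔-identityˡ _)
comb-++ (c ∷ cs) d (x ∷ xs) ys = trans (cong (c · x ∔_) (comb-++ cs d xs ys)) (sym (∔-assoc _ _ _))

unit : Fin k → Vec Bool k
unit zero    = true ∷ zeros
unit (suc i) = false ∷ unit i

comb-unit : (i : Fin k) (vs : Vec (Vec Bool n) k) → comb (unit i) vs ≡ lookup vs i
comb-unit zero    (v ∷ vs) = trans (cong (v ∔_) (comb-zeros vs)) (∔-identityʳ v)
comb-unit (suc i) (v ∷ vs) = trans (∔-identityˡ _) (comb-unit i vs)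

dot : Vec Bool k → Vec Bool k → Bool
dot []       []       = false
dot (c ∷ cs) (d ∷ ds) = (c ∧ d) xor dot cs ds

dot-comm : (c d : Vec Bool k) → dot c d ≡ dot d c
dot-comm []       []       = refl
dot-comm (c ∷ cs) (d ∷ ds) = cong₂ _xor_ (∧-comm c d) (dot-comm cs ds)

dot-zerosʳ : (c : Vec Bool k) → dot c zeros ≡ false
dot-zerosʳ []       = refl
dot-zerosʳ (c ∷ cs) = trans (cong (_xor dot cs zeros) (∧-zeroʳ c)) (dot-zerosʳ cs)

dot-nondegenerate : (b : Vec Bool k) → (∀ c → dot b c ≡ false) → b ≡ zeros
dot-nondegenerate []       _   = refl
dot-nondegenerate (b ∷ bs) ⊥all = cong₂ _∷_ head (dot-nondegenerate bs tail)
  where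
  head : b ≡ false
  head = trans (sym (trans (cong₂ _xor_ (∧-identityʳ b) (dot-zerosʳ bs)) (xor-identityʳ b))) (⊥all (true ∷ zeros))
  tail : ∀ c → dot bs c ≡ false
  tail c = trans (cong (_xor dot bs c) (sym (∧-zeroʳ b))) (⊥all (false ∷ c))

∈-allVec : (w : Vec Bool n) → w ∈ allVec n
∈-allVec []          = here refl
∈-allVec (false ∷ w) = ∈-++⁺ˡ (∈-map⁺ (false ∷_) (∈-allVec w))
∈-allVec (true ∷ w)  = ∈-++⁺ʳ (List.map (false ∷_) (allVec _)) (∈-map⁺ (true ∷_) (∈-allVec w))

∀-Vec? : {P : Vec Bool n → Set} → Decidable P → Dec (∀ w → P w)
∀-Vec? P? = map′ (λ all w → ListAll.lookup all (∈-allVec w)) (λ all → ListAll.tabulate λ {w} _ → all w)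
                 (ListAll.all? P? (allVec _))

∃-Vec? : {P : Vec Bool n → Set} → Decidable P → Dec (∃ P)
∃-Vec? P? = map′ Any.satisfied (λ (w , pw) → lose (∈-allVec w) pw) (Any.any? P? (allVec _))

_≟ᵛ_ : DecidableEquality (Vec Bool n)
_≟ᵛ_ = Vec.≡-dec Bool._≟_

module VecMembership {n : ℕ} = Data.List.Membership.DecPropositional (_≟ᵛ_ {n})
open VecMembership using (_∈?_)
open import Data.List.Relation.Unary.Unique.DecPropositional (_≟ᵛ_ {7}) using (unique?)

tally : {A : Set} → (A → Bool) → List A → ℕ
tally f xs = sum (List.map (λ x → if f x then 1 else 0) xs)

count : (Vec Bool n → Bool) → ℕ
count {n} f = tally f (allVec n)

tally-++ : {A : Set} (f : A → Bool) (xs ys : List A) → tally f (xs List.++ ys) ≡ tally f xs + tally f ys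
tally-++ f xs ys = trans (cong sum (map-++ _ xs ys)) (sum-++ (List.map _ xs) _)

tally-map : {A B : Set} (f : B → Bool) (h : A → B) (xs : List A) → tally f (List.map h xs) ≡ tally (f ∘ h) xs
tally-map f h []       = refl
tally-map f h (x ∷ xs) = cong (_ +_) (tally-map f h xs)

tally-false : {A : Set} (xs : List A) → tally (λ _ → false) xs ≡ 0
tally-false []       = refl
tally-false (x ∷ xs) = tally-false xs

tally-⊎ : {A : Set} {P Q : A → Set} (P? : Decidable P) (Q? : Decidable Q) (xs : List A) →
          (∀ {x} → P x → ¬ Q x) →
          tally (λ x → does (P? x) ∨ does (Q? x)) xs ≡ tally (does ∘ P?) xs + tally (does ∘ Q?) xs
tally-⊎ P? Q? []       disjoint = refl
tally-⊎ P? Q? (x ∷ xs) disjoint with P? x | Q? x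
... | yes p | yes q = contradiction q (disjoint p)
... | yes _ | no _  = cong suc (tally-⊎ P? Q? xs disjoint)
... | no _  | yes _ = trans (cong suc (tally-⊎ P? Q? xs disjoint)) (sym (+-suc _ _))
... | no _  | no _  = tally-⊎ P? Q? xs disjoint

count-≡ : (y : Vec Bool n) → count (λ x → does (x ≟ᵛ y)) ≡ 1
count-≡ []      = refl
count-≡ {suc n} (b ∷ y) = begin
  tally (λ x → does (x ≟ᵛ (b ∷ y))) (List.map (false ∷_) (allVec n) List.++ List.map (true ∷_) (allVec n))
    ≡⟨ tally-++ _ (List.map (false ∷_) (allVec n)) _ ⟩
  tally _ (List.map (false ∷_) (allVec n)) + tally _ (List.map (true ∷_) (allVec n))
    ≡⟨ cong₂ _+_ (tally-map _ (false ∷_) (allVec n)) (tally-map _ (true ∷_) (allVec n)) ⟩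
  tally (λ x → does (false Bool.≟ b) ∧ does (x ≟ᵛ y)) (allVec n)
    + tally (λ x → does (true Bool.≟ b) ∧ does (x ≟ᵛ y)) (allVec n)
    ≡⟨ halves b ⟩
  1 ∎
  where
  open ≡-Reasoning
  halves : ∀ b → tally (λ x → does (false Bool.≟ b) ∧ does (x ≟ᵛ y)) (allVec n)
               + tally (λ x → does (true Bool.≟ b) ∧ does (x ≟ᵛ y)) (allVec n) ≡ 1
  halves false = cong₂ _+_ (count-≡ y) (tally-false (allVec n))
  halves true  = cong₂ _+_ (tally-false (allVec n)) (count-≡ y)

count-∈ : {ys : List (Vec Bool n)} → Unique ys → count (λ x → does (x ∈? ys)) ≡ length ys
count-∈ {n} {ys = []} [] = tally-false (allVec n)
count-∈ {ys = y ∷ ys} (y∉ys ∷ uniq) = begin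
  tally (λ x → does (x ≟ᵛ y) ∨ does (x ∈? ys)) (allVec _)
    ≡⟨ tally-⊎ (_≟ᵛ y) (_∈? ys) (allVec _) (λ { refl → All¬⇒¬Any y∉ys }) ⟩
  count (λ x → does (x ≟ᵛ y)) + count (λ x → does (x ∈? ys))
    ≡⟨ cong₂ _+_ (count-≡ y) (count-∈ uniq) ⟩
  suc (length ys) ∎
  where open ≡-Reasoning

Vec↔Fin : Vec Bool n ↔ Fin (2 ^ n)
Vec↔Fin {zero}  = mk↔ₛ′ (λ _ → zero) (λ _ → []) (λ { zero → refl }) (λ { [] → refl })
Vec↔Fin {suc n} = ↔-trans uncons (↔-trans (↔-sym 2↔Bool ×-↔ Vec↔Fin) (↔-sym *↔×))
  where
  uncons : Vec Bool (suc n) ↔ (Bool × Vec Bool n)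
  uncons = mk↔ₛ′ (λ { (b ∷ w) → b , w }) (λ (b , w) → b ∷ w) (λ _ → refl) (λ { (b ∷ w) → refl })

toFin : Vec Bool n → Fin (2 ^ n)
toFin {n} = Inverse.to (Vec↔Fin {n})

fromFin : Fin (2 ^ n) → Vec Bool n
fromFin {n} = Inverse.from (Vec↔Fin {n})

toFin-injective : {v w : Vec Bool n} → toFin v ≡ toFin w → v ≡ w
toFin-injective {n} {v} {w} e = begin
  v                ≡⟨ Inverse.strictlyInverseʳ (Vec↔Fin {n}) v ⟨
  fromFin (toFin v) ≡⟨ cong fromFin e ⟩
  fromFin (toFin w) ≡⟨ Inverse.strictlyInverseʳ (Vec↔Fin {n}) w ⟩
  w                ∎
  where open ≡-Reasoning

fromFin-injective : {i j : Fin (2 ^ n)} → fromFin {n} i ≡ fromFin j → i ≡ j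
fromFin-injective {n} {i} {j} e = begin
  i                 ≡⟨ Inverse.strictlyInverseˡ (Vec↔Fin {n}) i ⟨
  toFin (fromFin {n} i) ≡⟨ cong toFin e ⟩
  toFin (fromFin {n} j) ≡⟨ Inverse.strictlyInverseˡ (Vec↔Fin {n}) j ⟩
  j                 ∎
  where open ≡-Reasoning

-- Two of the 2ⁿ⁺¹ combinations of n + 1 vectors coincide.
dependent : (vs : Vec (Vec Bool n) (suc n)) → ∃ λ c → c ≢ zeros × comb c vs ≡ zeros
dependent {n} vs = from-collision (pigeonhole (^-monoʳ-< 2 (s≤s (s≤s z≤n)) (n<1+n n)) value)
  where
  open ≡-Reasoning
  coeffs : Fin (2 ^ suc n) → Vec Bool (suc n)
  coeffs = fromFin
  value : Fin (2 ^ suc n) → Fin (2 ^ n)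
  value i = toFin (comb (coeffs i) vs)
  from-collision : (∃₂ λ i j → i < j × value i ≡ value j) → ∃ λ c → c ≢ zeros × comb c vs ≡ zeros
  from-collision (i , j , i<j , same) =
    coeffs i ∔ coeffs j ,
    <⇒≢ i<j ∘ fromFin-injective {suc n} ∘ ∔≡zeros⇒≡ (coeffs i) (coeffs j) ,
    (begin
      comb (coeffs i ∔ coeffs j) vs             ≡⟨ comb-∔ (coeffs i) (coeffs j) vs ⟩
      comb (coeffs i) vs ∔ comb (coeffs j) vs   ≡⟨ cong (comb (coeffs i) vs ∔_) (toFin-injective {n} same) ⟨
      comb (coeffs i) vs ∔ comb (coeffs i) vs   ≡⟨ ∔-self _ ⟩
      zeros                                     ∎)

xor-cancelʳ : ∀ a b → (a xor b) xor b ≡ a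
xor-cancelʳ a b = trans (xor-assoc a b b) (trans (cong (a xor_) (xor-same b)) (xor-identityʳ a))

record Subspace (G : V → Set) : Set where
  field
    0v∈ : G 0v
    ⊕∈  : ∀ {x y} → G x → G y → G (x ⊕ y)

  ·∈ : ∀ c {x} → G x → G (c · x)
  ·∈ true  x∈ = x∈
  ·∈ false _  = 0v∈

  comb∈ : (c : Vec Bool k) {xs : Vec V k} → All G xs → G (comb c xs)
  comb∈ []       []          = 0v∈
  comb∈ (c ∷ cs) (x∈ ∷ xs∈) = ⊕∈ (·∈ c x∈) (comb∈ cs xs∈)

InSpan-subspace : {xs : Vec V k} → Subspace (InSpan xs)
InSpan-subspace {xs = xs} = record
  { 0v∈ = zeros , trans (lincomb≡comb zeros xs) (comb-zeros xs)
  ; ⊕∈  = λ (c , c≡) (d , d≡) → c ∔ d , (begin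
      lincomb (c ∔ d) xs          ≡⟨ lincomb≡comb (c ∔ d) xs ⟩
      comb (c ∔ d) xs             ≡⟨ comb-∔ c d xs ⟩
      comb c xs ∔ comb d xs       ≡⟨ cong₂ _∔_ (lincomb≡comb c xs) (lincomb≡comb d xs) ⟨
      lincomb c xs ⊕ lincomb d xs ≡⟨ cong₂ _⊕_ c≡ d≡ ⟩
      _                           ∎)
  }
  where open ≡-Reasoning

-- `UpperGram k` holds polar values bᵢⱼ (i < j) row by row; `quadratic d G` is the quadratic form on
-- GF(2)ᵏ with diagonal values d and polar values G.
UpperGram : ℕ → Set
UpperGram zero    = ⊤
UpperGram (suc k) = Vec Bool k × UpperGram k

quadratic : Vec Bool k → UpperGram k → Vec Bool k → Bool
quadratic []       tt      []       = false
quadratic (d ∷ ds) (r , G) (c ∷ cs) = (c ∧ dot cs r) xor (c ∧ d) xor quadratic ds G cs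

module QuadraticForm (q : V → Bool) (isQ : IsQuadForm q) where

  β : V → V → Bool
  β = polar q

  q-0v : q 0v ≡ false
  q-0v = proj₁ isQ

  β-additiveˡ : ∀ x y z → β (x ⊕ y) z ≡ β x z xor β y z
  β-additiveˡ = proj₂ isQ

  q-⊕ : ∀ x y → q (x ⊕ y) ≡ β x y xor q x xor q y
  q-⊕ x y = sym (xor-cancelʳ (q (x ⊕ y)) (q x xor q y))

  β-sym : ∀ x y → β x y ≡ β y x
  β-sym x y = cong₂ _xor_ (cong q (∔-comm x y)) (xor-comm (q x) (q y))

  β-self : ∀ x → β x x ≡ false
  β-self x = begin
    q (x ⊕ x) xor q x xor q x ≡⟨ cong₂ _xor_ (trans (cong q (∔-self x)) q-0v) (xor-same (q x)) ⟩
    false                     ∎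
    where open ≡-Reasoning

  β-0vˡ : ∀ y → β 0v y ≡ false
  β-0vˡ y = begin
    β 0v y              ≡⟨ cong (λ u → β u y) (∔-self 0v) ⟨
    β (0v ⊕ 0v) y       ≡⟨ β-additiveˡ 0v 0v y ⟩
    β 0v y xor β 0v y   ≡⟨ xor-same (β 0v y) ⟩
    false               ∎
    where open ≡-Reasoning

  β-0vʳ : ∀ x → β x 0v ≡ false
  β-0vʳ x = trans (β-sym x 0v) (β-0vˡ x)

  β-additiveʳ : ∀ x y z → β x (y ⊕ z) ≡ β x y xor β x z
  β-additiveʳ x y z = begin
    β x (y ⊕ z)       ≡⟨ β-sym x (y ⊕ z) ⟩
    β (y ⊕ z) x       ≡⟨ β-additiveˡ y z x ⟩
    β y x xor β z x   ≡⟨ cong₂ _xor_ (β-sym y x) (β-sym z x) ⟩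
    β x y xor β x z   ∎
    where open ≡-Reasoning

  β-·ˡ : ∀ c x y → β (c · x) y ≡ c ∧ β x y
  β-·ˡ true  x y = refl
  β-·ˡ false x y = β-0vˡ y

  β-·ʳ : ∀ c x y → β x (c · y) ≡ c ∧ β x y
  β-·ʳ true  x y = refl
  β-·ʳ false x y = β-0vʳ x

  β-combˡ : (c : Vec Bool k) (xs : Vec V k) (y : V) → β (comb c xs) y ≡ dot c (map (λ x → β x y) xs)
  β-combˡ []       []       y = β-0vˡ y
  β-combˡ (c ∷ cs) (x ∷ xs) y =
    trans (β-additiveˡ (c · x) (comb cs xs) y) (cong₂ _xor_ (β-·ˡ c x y) (β-combˡ cs xs y))

  β-combʳ : (c : Vec Bool k) (xs : Vec V k) (y : V) → β y (comb c xs) ≡ dot c (map (β y) xs)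
  β-combʳ []       []       y = β-0vʳ y
  β-combʳ (c ∷ cs) (x ∷ xs) y =
    trans (β-additiveʳ y (c · x) (comb cs xs)) (cong₂ _xor_ (β-·ʳ c y x) (β-combʳ cs xs y))

  q-· : ∀ c x → q (c · x) ≡ c ∧ q x
  q-· true  x = refl
  q-· false x = q-0v

  β-singular : ∀ {x y} → q x ≡ false → q y ≡ false → β x y ≡ q (x ⊕ y)
  β-singular {x} {y} qx qy = trans (cong₂ (λ a b → q (x ⊕ y) xor a xor b) qx qy) (xor-identityʳ _)

  isotropic : {G : V → Set} → Subspace G → (∀ {x} → G x → q x ≡ false) →
              ∀ {x y} → G x → G y → β x y ≡ false
  isotropic G-sub G-sing x∈ y∈ = trans (β-singular (G-sing x∈) (G-sing y∈)) (G-sing (Subspace.⊕∈ G-sub x∈ y∈))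

  generator-isotropic : {xs : Vec V 4} → Generator q xs → ∀ {x y} → InSpan xs x → InSpan xs y → β x y ≡ false
  generator-isotropic (_ , sing) = isotropic InSpan-subspace (λ {x} → sing x)

  gram : Vec V k → UpperGram k
  gram []       = tt
  gram (x ∷ xs) = map (β x) xs , gram xs

  q-comb : (c : Vec Bool k) (xs : Vec V k) → q (comb c xs) ≡ quadratic (map q xs) (gram xs) c
  q-comb []       []       = q-0v
  q-comb (c ∷ cs) (x ∷ xs) = begin
    q (c · x ⊕ comb cs xs)                                   ≡⟨ q-⊕ (c · x) (comb cs xs) ⟩
    β (c · x) (comb cs xs) xor q (c · x) xor q (comb cs xs)   ≡⟨ cong₂ _xor_ β-part (cong₂ _xor_ (q-· c x) (q-comb cs xs)) ⟩
    (c ∧ dot cs (map (β x) xs)) xor (c ∧ q x) xor quadratic (map q xs) (gram xs) cs ∎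
    where
    open ≡-Reasoning
    β-part : β (c · x) (comb cs xs) ≡ c ∧ dot cs (map (β x) xs)
    β-part = trans (β-·ˡ c x (comb cs xs)) (cong (c ∧_) (β-combʳ cs xs x))

module Duality (q : V → Bool) (isQ : IsQuadForm q) where

  open QuadraticForm q isQ

  Dual : Vec V k → Vec V k → Set
  Dual xs fs = ∀ c → map (β (comb c xs)) fs ≡ c

  Separates : (V → Set) → Vec V k → Set
  Separates G xs = ∀ c → c ≢ zeros → ∃ λ w → G w × β (comb c xs) w ≡ true

  β-comb-dual : {xs fs : Vec V k} → Dual xs fs → ∀ c d → β (comb c xs) (comb d fs) ≡ dot d c
  β-comb-dual {xs = xs} {fs} dual c d = trans (β-combʳ d fs (comb c xs)) (cong (dot d) (dual c))

  map-β-additiveˡ : ∀ x y (fs : Vec V k) → map (β (x ⊕ y)) fs ≡ map (β x) fs ∔ map (β y) fs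
  map-β-additiveˡ x y []       = refl
  map-β-additiveˡ x y (f ∷ fs) = cong₂ _∷_ (β-additiveˡ x y f) (map-β-additiveˡ x y fs)

  separates-tail : ∀ {G x} {xs : Vec V k} → Separates G (x ∷ xs) → Separates G xs
  separates-tail sep c c≢0 with sep (false ∷ c) (λ e → c≢0 (cong Data.Vec.tail e))
  ... | w , w∈ , pairs = w , w∈ , trans (cong (λ u → β u w) (sym (∔-identityˡ (comb c _)))) pairs

  -- A witness w for x̃ = x ⊕ Σ β(x, fⱼ) xⱼ, which is orthogonal to fs, corrected to be orthogonal to xs.
  separating-vector : ∀ {G x} {xs fs : Vec V k} → Subspace G → Separates G (x ∷ xs) → All G fs → Dual xs fs →
                      ∃ λ f₀ → G f₀ × (∀ c → β (comb c xs) f₀ ≡ false) × β x f₀ ≡ true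
  separating-vector {x = x} {xs} {fs} G-sub sep fs∈ dual with sep (true ∷ map (β x) fs) (λ ())
  ... | w , w∈ , x̃w = f₀ , Subspace.⊕∈ G-sub w∈ (Subspace.comb∈ G-sub d fs∈) , xs⊥f₀ , xf₀
    where
    open ≡-Reasoning
    a = map (β x) fs
    x̃ = x ⊕ comb a xs
    d = map (λ y → β y w) xs
    f₀ = w ⊕ comb d fs

    xs⊥f₀ : ∀ c → β (comb c xs) f₀ ≡ false
    xs⊥f₀ c = begin
      β (comb c xs) (w ⊕ comb d fs)                ≡⟨ β-additiveʳ (comb c xs) w (comb d fs) ⟩
      β (comb c xs) w xor β (comb c xs) (comb d fs) ≡⟨ cong₂ _xor_ (β-combˡ c xs w) (β-comb-dual dual c d) ⟩
      dot c d xor dot d c                           ≡⟨ cong (dot c d xor_) (dot-comm d c) ⟩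
      dot c d xor dot c d                           ≡⟨ xor-same (dot c d) ⟩
      false                                         ∎

    x̃⊥fs : map (β x̃) fs ≡ zeros
    x̃⊥fs = trans (map-β-additiveˡ x (comb a xs) fs) (trans (cong (a ∔_) (dual a)) (∔-self a))

    xf₀ : β x f₀ ≡ true
    xf₀ = begin
      β x f₀                          ≡⟨ xor-identityʳ (β x f₀) ⟨
      β x f₀ xor false                ≡⟨ cong (β x f₀ xor_) (xs⊥f₀ a) ⟨
      β x f₀ xor β (comb a xs) f₀     ≡⟨ β-additiveˡ x (comb a xs) f₀ ⟨
      β x̃ f₀                          ≡⟨ β-additiveʳ x̃ w (comb d fs) ⟩
      β x̃ w xor β x̃ (comb d fs)       ≡⟨ cong₂ _xor_ x̃w (trans (β-combʳ d fs x̃) (cong (dot d) x̃⊥fs)) ⟩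
      true xor dot d zeros            ≡⟨ cong (true xor_) (dot-zerosʳ d) ⟩
      true                            ∎

  dual-cons : ∀ {x f₀} {xs fs : Vec V k} → Dual xs fs → (∀ c → β (comb c xs) f₀ ≡ false) → β x f₀ ≡ true →
              Dual (x ∷ xs) (f₀ ∷ map (λ f → f ⊕ β x f · f₀) fs)
  dual-cons {x = x} {f₀} {xs} {fs} dual xs⊥f₀ xf₀ (c₀ ∷ c) = cong₂ _∷_ pair-f₀ (begin
    map (β y) (map shift fs)          ≡⟨ map-∘ (β y) shift fs ⟨
    map (λ f → β y (shift f)) fs      ≡⟨ map-cong pair-shift fs ⟩
    map (β (comb c xs)) fs            ≡⟨ dual c ⟩
    c                                 ∎)
    where
    open ≡-Reasoning
    y = c₀ · x ⊕ comb c xs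
    shift : V → V
    shift f = f ⊕ β x f · f₀
    pair-f₀ : β y f₀ ≡ c₀
    pair-f₀ = begin
      β y f₀                              ≡⟨ β-additiveˡ (c₀ · x) (comb c xs) f₀ ⟩
      β (c₀ · x) f₀ xor β (comb c xs) f₀  ≡⟨ cong₂ _xor_ (trans (β-·ˡ c₀ x f₀) (cong (c₀ ∧_) xf₀)) (xs⊥f₀ c) ⟩
      c₀ ∧ true xor false                 ≡⟨ trans (xor-identityʳ _) (∧-identityʳ c₀) ⟩
      c₀                                  ∎
    pair-shift : ∀ f → β y (shift f) ≡ β (comb c xs) f
    pair-shift f = begin
      β y (f ⊕ β x f · f₀)                                ≡⟨ β-additiveʳ y f (β x f · f₀) ⟩
      β y f xor β y (β x f · f₀)                          ≡⟨ cong₂ _xor_ (β-additiveˡ (c₀ · x) (comb c xs) f)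
                                                                     (trans (β-·ʳ (β x f) y f₀) (cong (β x f ∧_) pair-f₀)) ⟩
      (β (c₀ · x) f xor β (comb c xs) f) xor (β x f ∧ c₀)  ≡⟨ cong (λ u → (u xor β (comb c xs) f) xor (β x f ∧ c₀))
                                                                     (trans (β-·ˡ c₀ x f) (∧-comm c₀ (β x f))) ⟩
      (β x f ∧ c₀ xor β (comb c xs) f) xor (β x f ∧ c₀)    ≡⟨ cong (_xor (β x f ∧ c₀)) (xor-comm (β x f ∧ c₀) _) ⟩
      (β (comb c xs) f xor β x f ∧ c₀) xor (β x f ∧ c₀)    ≡⟨ xor-cancelʳ (β (comb c xs) f) (β x f ∧ c₀) ⟩
      β (comb c xs) f                                     ∎

  dual-family : ∀ {G} {xs : Vec V k} → Subspace G → Separates G xs → ∃ λ fs → All G fs × Dual xs fs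
  dual-family {xs = []}     G-sub sep = [] , [] , λ { [] → refl }
  dual-family {xs = x ∷ xs} G-sub sep with dual-family G-sub (separates-tail sep)
  ... | fs , fs∈ , dual with separating-vector G-sub sep fs∈ dual
  ...   | f₀ , f₀∈ , xs⊥f₀ , xf₀ =
    f₀ ∷ map (λ f → f ⊕ β x f · f₀) fs ,
    f₀∈ ∷ map⁺ (VecAll.map (λ f∈ → Subspace.⊕∈ G-sub f∈ (Subspace.·∈ G-sub _ f₀∈)) fs∈) ,
    dual-cons dual xs⊥f₀ xf₀

  nonsingular-witness : Nonsingular q → ∀ {v} → v ≢ 0v → q v ≡ false → ∃ λ w → β v w ≡ true
  nonsingular-witness ns {v} v≢0 qv =
    decidable-stable (∃-Vec? {P = λ w → β v w ≡ true} (λ w → β v w Bool.≟ true)) not-all-orthogonal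
    where
    not-all-orthogonal : ¬ ¬ (∃ λ w → β v w ≡ true)
    not-all-orthogonal none = ns v tt v≢0 qv (λ w _ → ¬-not (λ vw → none (w , vw)))

  all-subspace : Subspace (λ _ → ⊤)
  all-subspace = record { 0v∈ = tt ; ⊕∈ = λ _ _ → tt }

  generator-separated : Nonsingular q → {xs : Vec V 4} → Generator q xs → Separates (λ _ → ⊤) xs
  generator-separated ns {xs} (indep , sing) c c≢0 = witness (nonsingular-witness ns nonzero singular)
    where
    nonzero : comb c xs ≢ 0v
    nonzero e = c≢0 (indep c (trans (lincomb≡comb c xs) e))
    singular : q (comb c xs) ≡ false
    singular = sing (comb c xs) (c , lincomb≡comb c xs)
    witness : (∃ λ w → β (comb c xs) w ≡ true) → ∃ λ w → ⊤ × β (comb c xs) w ≡ true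
    witness (w , pairs) = w , tt , pairs

  β-comb-orthogonal : ∀ {y} (xs : Vec V k) → map (β y) xs ≡ zeros → ∀ c → β (comb c xs) y ≡ false
  β-comb-orthogonal {y = y} xs y⊥xs c =
    trans (β-sym (comb c xs) y) (trans (β-combʳ c xs y) (trans (cong (dot c) y⊥xs) (dot-zerosʳ c)))

  -- Pair a relation Σ aᵢxᵢ + Σ bⱼfⱼ + ηy = 0 with each combination of xs.
  relation-dual-part : {xs fs : Vec V 4} → Generator q xs → Dual xs fs → ∀ {y} → map (β y) xs ≡ zeros →
                       ∀ a b η → comb a xs ∔ (comb b fs ∔ η · y) ≡ 0v → b ≡ zeros
  relation-dual-part {xs} {fs} gen dual {y} y⊥xs a b η relation = dot-nondegenerate b pairs
    where
    open ≡-Reasoning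
    pairs : ∀ c → dot b c ≡ false
    pairs c = begin
      dot b c                                                  ≡⟨ β-comb-dual dual c b ⟨
      β x (comb b fs)                                          ≡⟨ xor-identityʳ _ ⟨
      false xor β x (comb b fs) xor false                      ≡⟨ cong₂ (λ u v → u xor β x (comb b fs) xor v) xs⊥a xs⊥ηy ⟨
      β x (comb a xs) xor β x (comb b fs) xor β x (η · y)       ≡⟨ cong (β x (comb a xs) xor_) (β-additiveʳ x (comb b fs) (η · y)) ⟨
      β x (comb a xs) xor β x (comb b fs ∔ η · y)               ≡⟨ β-additiveʳ x (comb a xs) (comb b fs ∔ η · y) ⟨
      β x (comb a xs ∔ (comb b fs ∔ η · y))                     ≡⟨ cong (β x) relation ⟩
      β x 0v                                                   ≡⟨ β-0vʳ x ⟩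
      false                                                    ∎
      where
      x = comb c xs
      xs⊥a : β x (comb a xs) ≡ false
      xs⊥a = generator-isotropic gen (c , lincomb≡comb c xs) (a , lincomb≡comb a xs)
      xs⊥ηy : β x (η · y) ≡ false
      xs⊥ηy = trans (β-·ʳ η x y) (trans (cong (η ∧_) (β-comb-orthogonal xs y⊥xs c)) (∧-zeroʳ η))

  span-from-relation : {xs fs : Vec V 4} → Generator q xs → Dual xs fs → ∀ {y} → map (β y) xs ≡ zeros →
                       ∀ a b η → a ++ b ++ (η ∷ []) ≢ zeros → comb a xs ∔ (comb b fs ∔ η · y) ≡ 0v → InSpan xs y
  span-from-relation {xs} {fs} gen@(indep , _) dual {y} y⊥xs a b η nonzero relation = conclude η refl
    where
    b≡zeros : b ≡ zeros
    b≡zeros = relation-dual-part gen dual y⊥xs a b η relation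
    reduced : comb a xs ∔ η · y ≡ 0v
    reduced = trans (cong (comb a xs ∔_) (sym (trans (cong (λ u → comb u fs ∔ η · y) b≡zeros)
                                                     (trans (cong (_∔ η · y) (comb-zeros fs)) (∔-identityˡ (η · y))))))
                    relation
    conclude : ∀ η′ → η ≡ η′ → InSpan xs y
    conclude true  refl = a , trans (lincomb≡comb a xs) (∔≡zeros⇒≡ _ _ reduced)
    conclude false refl = ⊥-elim (nonzero (cong₂ _++_ a≡zeros (cong (_++ (false ∷ [])) b≡zeros)))
      where
      a≡zeros : a ≡ zeros
      a≡zeros = indep a (trans (lincomb≡comb a xs) (trans (sym (∔-identityʳ _)) reduced))

  generator-perp : Nonsingular q → {xs : Vec V 4} → Generator q xs →
                   ∀ {y} → map (β y) xs ≡ zeros → InSpan xs y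
  generator-perp ns {xs} gen {y} y⊥xs = from-dual (dual-family all-subspace (generator-separated ns gen))
    where
    from-dual : (∃ λ fs → All (λ _ → ⊤) fs × Dual xs fs) → InSpan xs y
    from-dual (fs , _ , dual) = from-dependence (dependent (xs ++ fs ++ (y ∷ [])))
      where
      open ≡-Reasoning
      from-dependence : (∃ λ c → c ≢ zeros × comb c (xs ++ fs ++ (y ∷ [])) ≡ 0v) → InSpan xs y
      from-dependence (c , c≢0 , relation) with splitAt 4 c
      ... | a , rest , refl with splitAt 4 rest
      ... | b , η ∷ [] , refl = span-from-relation gen dual y⊥xs a b η c≢0 (begin
        comb a xs ∔ (comb b fs ∔ η · y)               ≡⟨ cong (λ u → comb a xs ∔ (comb b fs ∔ u)) (∔-identityʳ (η · y)) ⟨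
        comb a xs ∔ (comb b fs ∔ (η · y ∔ 0v))        ≡⟨ cong (comb a xs ∔_) (comb-++ b (η ∷ []) fs (y ∷ [])) ⟨
        comb a xs ∔ comb (b ++ η ∷ []) (fs ++ y ∷ []) ≡⟨ comb-++ a (b ++ (η ∷ [])) xs (fs ++ (y ∷ [])) ⟨
        comb (a ++ b ++ η ∷ []) (xs ++ fs ++ y ∷ []) ≡⟨ relation ⟩
        0v                                          ∎)

line-points : ∀ {a b x} → PointOf (a ∷ b ∷ []) x → x ≡ a ⊎ x ≡ b ⊎ x ≡ a ⊕ b
line-points {a} {b} (x≢0 , (true  ∷ true  ∷ []) , refl) = inj₂ (inj₂ (cong (a ⊕_) (∔-identityʳ b)))
line-points {a} {b} (x≢0 , (true  ∷ false ∷ []) , refl) = inj₁ (trans (cong (a ⊕_) (∔-identityˡ 0v)) (∔-identityʳ a))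
line-points {a} {b} (x≢0 , (false ∷ true  ∷ []) , refl) = inj₂ (inj₁ (trans (∔-identityˡ _) (∔-identityʳ b)))
line-points {a} {b} (x≢0 , (false ∷ false ∷ []) , refl) = ⊥-elim (x≢0 (trans (∔-identityˡ _) (∔-identityˡ 0v)))

first-on-line : ∀ a b → InSpan (a ∷ b ∷ []) a
first-on-line a b = (true ∷ false ∷ []) , trans (cong (a ⊕_) (∔-identityˡ 0v)) (∔-identityʳ a)

second-on-line : ∀ a b → InSpan (a ∷ b ∷ []) b
second-on-line a b = (false ∷ true ∷ []) , trans (∔-identityˡ _) (∔-identityʳ b)

sum-on-line : ∀ a b → InSpan (a ∷ b ∷ []) (a ⊕ b)
sum-on-line a b = (true ∷ true ∷ []) , cong (a ⊕_) (∔-identityʳ b)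

≡⊕⇒≡0v : ∀ {a b} → a ≡ a ⊕ b → b ≡ 0v
≡⊕⇒≡0v {a} {b} e = trans (sym (∔-cancelˡ a b)) (trans (cong (a ⊕_) (sym e)) (∔-self a))

module Relations (q : V → Bool) (g : Vec V 4) where

  -- x ∼₁ y or x ∼₂ y, or x = y (then x ⊕ y = 0v ∈ Π)
  Joined : V → V → Set
  Joined x y = q (x ⊕ y) ≡ true ⊎ InSpan g (x ⊕ y)

  Rel1⇒secant : ∀ {a b} → Vertex q g a → Vertex q g b → Rel1 q g a b → a ≢ b × q (a ⊕ b) ≡ true
  Rel1⇒secant {a} {b} (a≢0 , qa , _) (b≢0 , qb , _) (x , y , x≢y , x∈ , _ , y∈ , _ , only-xy) =
    a≢b , secant (q (a ⊕ b)) refl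
    where
    a≢b : a ≢ b
    a≢b refl = x≢y (trans (on-diagonal x∈) (sym (on-diagonal y∈)))
      where
      on-diagonal : ∀ {z} → PointOf (a ∷ a ∷ []) z → z ≡ a
      on-diagonal z∈ with line-points z∈
      ... | inj₁ z≡a        = z≡a
      ... | inj₂ (inj₁ z≡a) = z≡a
      ... | inj₂ (inj₂ z≡0) = ⊥-elim (proj₁ z∈ (trans z≡0 (∔-self a)))
    a⊕b≢0 : a ⊕ b ≢ 0v
    a⊕b≢0 e = a≢b (∔≡zeros⇒≡ a b e)
    secant : ∀ t → q (a ⊕ b) ≡ t → q (a ⊕ b) ≡ true
    secant true  e = e
    secant false e = three-points (only-xy a (a≢0 , first-on-line a b) qa)
                                  (only-xy b (b≢0 , second-on-line a b) qb)
                                  (only-xy (a ⊕ b) (a⊕b≢0 , sum-on-line a b) e)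
      where
      three-points : a ≡ x ⊎ a ≡ y → b ≡ x ⊎ b ≡ y → a ⊕ b ≡ x ⊎ a ⊕ b ≡ y → q (a ⊕ b) ≡ true
      three-points (inj₁ ax) (inj₁ bx) _         = contradiction (trans ax (sym bx)) a≢b
      three-points (inj₂ ay) (inj₂ by) _         = contradiction (trans ay (sym by)) a≢b
      three-points (inj₁ ax) _ (inj₁ sx)         = contradiction (≡⊕⇒≡0v (trans ax (sym sx))) b≢0
      three-points (inj₂ ay) _ (inj₂ sy)         = contradiction (≡⊕⇒≡0v (trans ay (sym sy))) b≢0
      three-points _ (inj₁ bx) (inj₁ sx)         = contradiction (≡⊕⇒≡0v (trans (trans bx (sym sx)) (∔-comm a b))) a≢0
      three-points _ (inj₂ by) (inj₂ sy)         = contradiction (≡⊕⇒≡0v (trans (trans by (sym sy)) (∔-comm a b))) a≢0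

  Rel2⇒inΠ : ∀ {a b} → Vertex q g a → Vertex q g b → Rel2 q g a b → InSpan g (a ⊕ b)
  Rel2⇒inΠ (_ , _ , a∉Π) (_ , _ , b∉Π) (_ , x , x∈ , x∈Π , _) with line-points x∈
  ... | inj₁ refl        = ⊥-elim (a∉Π x∈Π)
  ... | inj₂ (inj₁ refl) = ⊥-elim (b∉Π x∈Π)
  ... | inj₂ (inj₂ refl) = x∈Π

  secant⇒Rel1 : ∀ {a b} → Vertex q g a → Vertex q g b → a ≢ b → q (a ⊕ b) ≡ true → Rel1 q g a b
  secant⇒Rel1 {a} {b} (a≢0 , qa , _) (b≢0 , qb , _) a≢b qab =
    a , b , a≢b , (a≢0 , first-on-line a b) , qa , (b≢0 , second-on-line a b) , qb , only-ab
    where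
    only-ab : ∀ z → PointOf (a ∷ b ∷ []) z → Sing q z → z ≡ a ⊎ z ≡ b
    only-ab z z∈ qz with line-points z∈
    ... | inj₁ z≡a        = inj₁ z≡a
    ... | inj₂ (inj₁ z≡b) = inj₂ z≡b
    ... | inj₂ (inj₂ refl) = contradiction (trans (sym qz) qab) λ ()

  inΠ⇒Rel2 : ∀ {a b} → Generator q g → Vertex q g a → Vertex q g b → a ≢ b → InSpan g (a ⊕ b) → Rel2 q g a b
  inΠ⇒Rel2 {a} {b} (_ , Π-singular) (_ , qa , a∉Π) (_ , qb , b∉Π) a≢b a⊕b∈Π =
    all-singular , a ⊕ b , (a⊕b≢0 , sum-on-line a b) , a⊕b∈Π , only-sum
    where
    a⊕b≢0 : a ⊕ b ≢ 0v
    a⊕b≢0 e = a≢b (∔≡zeros⇒≡ a b e)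
    all-singular : ∀ z → PointOf (a ∷ b ∷ []) z → Sing q z
    all-singular z z∈ with line-points z∈
    ... | inj₁ refl        = qa
    ... | inj₂ (inj₁ refl) = qb
    ... | inj₂ (inj₂ refl) = Π-singular (a ⊕ b) a⊕b∈Π
    only-sum : ∀ y → PointOf (a ∷ b ∷ []) y → InSpan g y → y ≡ a ⊕ b
    only-sum y y∈ y∈Π with line-points y∈
    ... | inj₁ refl        = ⊥-elim (a∉Π y∈Π)
    ... | inj₂ (inj₁ refl) = ⊥-elim (b∉Π y∈Π)
    ... | inj₂ (inj₂ y≡)   = y≡

  Adj⇒Joined : ∀ {a b} → Adj q g a b → Joined a b
  Adj⇒Joined (va , vb , _ , inj₁ r1) = inj₁ (proj₂ (Rel1⇒secant va vb r1))
  Adj⇒Joined (va , vb , _ , inj₂ r2) = inj₂ (Rel2⇒inΠ va vb r2)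

  Joined⇒Adj : ∀ {a b} → Generator q g → Vertex q g a → Vertex q g b → a ≢ b → Joined a b → Adj q g a b
  Joined⇒Adj gen va vb a≢b (inj₁ secant) = va , vb , a≢b , inj₁ (secant⇒Rel1 va vb a≢b secant)
  Joined⇒Adj gen va vb a≢b (inj₂ a⊕b∈Π)  = va , vb , a≢b , inj₂ (inΠ⇒Rel2 gen va vb a≢b a⊕b∈Π)

  clique-joined : ∀ {a b K} → Clique q g K → K a ≡ true → K b ≡ true → Joined a b
  clique-joined {a} {b} (_ , adjacent) Ka Kb with a ≟ᵛ b
  ... | yes refl = inj₂ (subst (InSpan g) (sym (∔-self a)) (Subspace.0v∈ InSpan-subspace))
  ... | no a≢b   = Adj⇒Joined (adjacent a b Ka Kb a≢b)

-- coordinates (a, c, t, s, w₁, w₂, w₃) with respect to the frame (A, C, T, S, W₁, W₂, W₃)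
Coords : Set
Coords = Vec Bool 7

q₇ : Coords → Bool
q₇ (a ∷ c ∷ t ∷ _ ∷ w₁ ∷ w₂ ∷ w₃ ∷ []) = a ∧ c xor a ∧ t xor c ∧ t xor a ∧ w₁ xor c ∧ w₂ xor t ∧ w₃

polar₇ : Coords → Coords → Bool
polar₇ v w = q₇ (v ∔ w) xor q₇ v xor q₇ w

ACT-coords : Coords → Vec Bool 3
ACT-coords (a ∷ c ∷ t ∷ _) = a ∷ c ∷ t ∷ []

InΠ₇ : Coords → Set
InΠ₇ w = ACT-coords w ≡ zeros

Joined₇ : Coords → Set
Joined₇ w = q₇ w ≡ true ⊎ InΠ₇ w

-- the polar values of q₇ on the frame, row by row above the diagonal
G₇ : UpperGram 7
G₇ = (true  ∷ true  ∷ false ∷ true  ∷ false ∷ false ∷ []) ,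
     (true  ∷ false ∷ false ∷ true  ∷ false ∷ []) ,
     (false ∷ false ∷ false ∷ true  ∷ []) ,
     (false ∷ false ∷ false ∷ []) ,
     (false ∷ false ∷ []) ,
     (false ∷ []) , [] , tt

-- the polar values on three pairwise secant singular points
G₃ : UpperGram 3
G₃ = (true ∷ true ∷ []) , (true ∷ []) , [] , tt

-- B = A ⊕ S and U = W₁ ⊕ W₂ ⊕ W₃ ∈ Π; the elliptic quadric in ⟨A, C, T, U⟩ has the points A, C, T, U
-- and X = A ⊕ C ⊕ T ⊕ U.
a₇ c₇ t₇ s₇ w₁₇ w₂₇ w₃₇ b₇ u₇ x₇ : Coords
a₇  = unit 0F
c₇  = unit 1F
t₇  = unit 2F
s₇  = unit 3F
w₁₇ = unit 4F
w₂₇ = unit 5F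
w₃₇ = unit 6F
b₇  = a₇ ∔ s₇
u₇  = w₁₇ ∔ w₂₇ ∔ w₃₇
x₇  = a₇ ∔ c₇ ∔ t₇ ∔ u₇

Ws₇ : Vec Coords 3
Ws₇ = w₁₇ ∷ w₂₇ ∷ w₃₇ ∷ []

units₇ : Vec Coords 7
units₇ = a₇ ∷ c₇ ∷ t₇ ∷ s₇ ∷ Ws₇

ABCT₇ : Vec Coords 4
ABCT₇ = a₇ ∷ b₇ ∷ c₇ ∷ t₇ ∷ []

conic₇ : Vec Coords 3
conic₇ = a₇ ∷ c₇ ∷ t₇ ∷ []

elliptic₇ : Vec Coords 4
elliptic₇ = a₇ ∷ c₇ ∷ t₇ ∷ u₇ ∷ []

-- the vertices Y and Y ⊕ S, Y ∈ {A, C, T, X}, of the cone S Q⁻(3,2)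
clique₇ : List Coords
clique₇ = a₇ ∷ b₇ ∷ c₇ ∷ c₇ ∔ s₇ ∷ t₇ ∷ t₇ ∔ s₇ ∷ x₇ ∷ x₇ ∔ s₇ ∷ []

InΠ₇? : ∀ w → Dec (InΠ₇ w)
InΠ₇? w = ACT-coords w ≟ᵛ zeros

Joined₇? : ∀ w → Dec (Joined₇ w)
Joined₇? w = q₇ w Bool.≟ true ⊎-dec InΠ₇? w

Independent₇ : Vec Coords k → Set
Independent₇ ds = ∀ c → comb c ds ≡ zeros → c ≡ zeros

Independent₇? : (ds : Vec Coords k) → Dec (Independent₇ ds)
Independent₇? ds = ∀-Vec? λ c → comb c ds ≟ᵛ zeros →-dec c ≟ᵛ zeros

NonsingularOn₇ : Vec Coords k → Set
NonsingularOn₇ ds = ∀ c → comb c ds ≢ zeros → q₇ (comb c ds) ≡ false →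
                    ∃ λ c′ → polar₇ (comb c ds) (comb c′ ds) ≡ true

NonsingularOn₇? : (ds : Vec Coords k) → Dec (NonsingularOn₇ ds)
NonsingularOn₇? ds = ∀-Vec? λ c → ¬? (comb c ds ≟ᵛ zeros) →-dec q₇ (comb c ds) Bool.≟ false →-dec
                                   ∃-Vec? λ c′ → polar₇ (comb c ds) (comb c′ ds) Bool.≟ true

SubSpan₇ : ∀ {l} → Vec Coords k → Vec Coords l → Set
SubSpan₇ ds ds′ = ∀ c → ∃ λ c′ → comb c′ ds′ ≡ comb c ds

SubSpan₇? : ∀ {l} (ds : Vec Coords k) (ds′ : Vec Coords l) → Dec (SubSpan₇ ds ds′)
SubSpan₇? ds ds′ = ∀-Vec? λ c → ∃-Vec? λ c′ → comb c′ ds′ ≟ᵛ comb c ds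

Independent₇-tail : ∀ {d} {ds : Vec Coords k} → Independent₇ (d ∷ ds) → Independent₇ ds
Independent₇-tail {d = d} {ds} indep c e = cong Data.Vec.tail (indep (false ∷ c) (trans (∔-identityˡ (comb c ds)) e))

-- Each fact below is decided by evaluating a decision procedure on all of its finite domain; the block is
-- opaque so that this evaluation is not repeated where the facts are used.
opaque
  q₇-from-gram : ∀ w → quadratic zeros G₇ w ≡ q₇ w
  q₇-from-gram = from-yes (∀-Vec? λ w → quadratic zeros G₇ w Bool.≟ q₇ w)

  triangle-singular-points : ∀ c → c ≢ zeros → quadratic zeros G₃ c ≡ false →
                             c ≡ unit 0F ⊎ c ≡ unit 1F ⊎ c ≡ unit 2F
  triangle-singular-points = from-yes (∀-Vec? λ c → ¬? (c ≟ᵛ zeros) →-dec quadratic zeros G₃ c Bool.≟ false →-dec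
                                                  (c ≟ᵛ unit 0F ⊎-dec c ≟ᵛ unit 1F ⊎-dec c ≟ᵛ unit 2F))

  pairing₇ : ∀ w → map (polar₇ w) Ws₇ ≡ ACT-coords w
  pairing₇ = from-yes (∀-Vec? λ w → map (polar₇ w) Ws₇ ≟ᵛ ACT-coords w)

  s₇-radical : ∀ w → polar₇ w s₇ ≡ false
  s₇-radical = from-yes (∀-Vec? λ w → polar₇ w s₇ Bool.≟ false)

  radical₇ : ∀ w → map (polar₇ w) units₇ ≡ zeros → w ≡ zeros ⊎ w ≡ s₇
  radical₇ = from-yes (∀-Vec? λ w → map (polar₇ w) units₇ ≟ᵛ zeros →-dec (w ≟ᵛ zeros ⊎-dec w ≟ᵛ s₇))

  q₇-s₇ : ∀ w → q₇ (s₇ ∔ w) ≡ q₇ w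
  q₇-s₇ (a ∷ c ∷ t ∷ s ∷ w₁ ∷ w₂ ∷ w₃ ∷ []) = refl

  Π₇-basis-independent : Independent₇ (s₇ ∷ Ws₇)
  Π₇-basis-independent = from-yes (Independent₇? (s₇ ∷ Ws₇))

  clique₇-vertices : ListAll.All (λ w → q₇ w ≡ false × ¬ InΠ₇ w) clique₇
  clique₇-vertices = from-yes (ListAll.all? (λ w → q₇ w Bool.≟ false ×-dec ¬? (InΠ₇? w)) clique₇)

  clique₇-joined : ListAll.All (λ w → ListAll.All (λ v → Joined₇ (w ∔ v)) clique₇) clique₇
  clique₇-joined = from-yes (ListAll.all? (λ w → ListAll.all? (λ v → Joined₇? (w ∔ v)) clique₇) clique₇)

  clique₇-maximal : ∀ w → q₇ w ≡ false → ¬ InΠ₇ w →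
                    Joined₇ (w ∔ a₇) → Joined₇ (w ∔ b₇) → Joined₇ (w ∔ c₇) → Joined₇ (w ∔ t₇) →
                    w ∈ clique₇
  clique₇-maximal = from-yes (∀-Vec? λ w → q₇ w Bool.≟ false →-dec ¬? (InΠ₇? w) →-dec
    Joined₇? (w ∔ a₇) →-dec Joined₇? (w ∔ b₇) →-dec Joined₇? (w ∔ c₇) →-dec Joined₇? (w ∔ t₇) →-dec
    w ∈? clique₇)

  clique₇-unique : Unique clique₇
  clique₇-unique = from-yes (unique? clique₇)

  ABCT₇-independent : Independent₇ ABCT₇
  ABCT₇-independent = from-yes (Independent₇? ABCT₇)

  conic-cone₇-independent : Independent₇ (s₇ ∷ conic₇)
  conic-cone₇-independent = from-yes (Independent₇? (s₇ ∷ conic₇))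

  elliptic-cone₇-independent : Independent₇ (s₇ ∷ elliptic₇)
  elliptic-cone₇-independent = from-yes (Independent₇? (s₇ ∷ elliptic₇))

  Π-line₇-independent : Independent₇ (s₇ ∷ u₇ ∷ [])
  Π-line₇-independent = from-yes (Independent₇? (s₇ ∷ u₇ ∷ []))

  conic-cone₇-in-ABCT : SubSpan₇ (s₇ ∷ conic₇) ABCT₇
  conic-cone₇-in-ABCT = from-yes (SubSpan₇? (s₇ ∷ conic₇) ABCT₇)

  conic₇-nonsingular : NonsingularOn₇ conic₇
  conic₇-nonsingular = from-yes (NonsingularOn₇? conic₇)

  elliptic₇-nonsingular : NonsingularOn₇ elliptic₇
  elliptic₇-nonsingular = from-yes (NonsingularOn₇? elliptic₇)

  conic₇-avoids-Π : ∀ c → comb c conic₇ ≢ zeros → q₇ (comb c conic₇) ≡ false → ¬ InΠ₇ (comb c conic₇)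
  conic₇-avoids-Π = from-yes (∀-Vec? λ c → ¬? (comb c conic₇ ≟ᵛ zeros) →-dec q₇ (comb c conic₇) Bool.≟ false →-dec
                                            ¬? (InΠ₇? (comb c conic₇)))

  elliptic₇-no-line : ∀ c c′ → Independent₇ (comb c elliptic₇ ∷ comb c′ elliptic₇ ∷ []) →
                      ¬ (q₇ (comb c elliptic₇) ≡ false × q₇ (comb c′ elliptic₇) ≡ false ×
                         q₇ (comb c elliptic₇ ∔ comb c′ elliptic₇) ≡ false)
  elliptic₇-no-line = from-yes (∀-Vec? λ c → ∀-Vec? λ c′ →
    Independent₇? (comb c elliptic₇ ∷ comb c′ elliptic₇ ∷ []) →-dec
    ¬? (q₇ (comb c elliptic₇) Bool.≟ false ×-dec q₇ (comb c′ elliptic₇) Bool.≟ false ×-dec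
        q₇ (comb c elliptic₇ ∔ comb c′ elliptic₇) Bool.≟ false))

  cone₇-meets-Π-in-line : ∀ c → InΠ₇ (comb c (s₇ ∷ elliptic₇)) →
                          ∃ λ c′ → comb c′ (s₇ ∷ u₇ ∷ []) ≡ comb c (s₇ ∷ elliptic₇)
  cone₇-meets-Π-in-line = from-yes (∀-Vec? λ c → InΠ₇? (comb c (s₇ ∷ elliptic₇)) →-dec
                                                 ∃-Vec? λ c′ → comb c′ (s₇ ∷ u₇ ∷ []) ≟ᵛ comb c (s₇ ∷ elliptic₇))

  Π-line₇-in-cone : SubSpan₇ (s₇ ∷ u₇ ∷ []) (s₇ ∷ elliptic₇)
  Π-line₇-in-cone = from-yes (SubSpan₇? (s₇ ∷ u₇ ∷ []) (s₇ ∷ elliptic₇))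

  Π-line₇-in-Π : ∀ c → InΠ₇ (comb c (s₇ ∷ u₇ ∷ []))
  Π-line₇-in-Π = from-yes (∀-Vec? λ c → InΠ₇? (comb c (s₇ ∷ u₇ ∷ [])))

  clique₇-in-cone : ListAll.All (λ w → ∃ λ c → comb c (s₇ ∷ elliptic₇) ≡ w) clique₇
  clique₇-in-cone = from-yes (ListAll.all? (λ w → ∃-Vec? λ c → comb c (s₇ ∷ elliptic₇) ≟ᵛ w) clique₇)

  cone₇-vertices-in-clique : ∀ c → q₇ (comb c (s₇ ∷ elliptic₇)) ≡ false → ¬ InΠ₇ (comb c (s₇ ∷ elliptic₇)) →
                             comb c (s₇ ∷ elliptic₇) ∈ clique₇
  cone₇-vertices-in-clique = from-yes (∀-Vec? λ c → q₇ (comb c (s₇ ∷ elliptic₇)) Bool.≟ false →-dec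
                                                    ¬? (InΠ₇? (comb c (s₇ ∷ elliptic₇))) →-dec
                                                    comb c (s₇ ∷ elliptic₇) ∈? clique₇)

ConeOverConic : (q : V → Bool) (g : Vec V 4) (P Q R T S : V) → Set
ConeOverConic q g P Q R T S = Σ (Vec V 3) λ b → SubSpan (S ∷ b) (P ∷ Q ∷ R ∷ T ∷ [])
  × NondegConic q b
  × IsCone q S b
  × (∀ x → PointOf b x → Sing q x → ¬ InSpan g x)

EllipticConeOf : (q : V → Bool) (g : Vec V 4) (S : V) (K : V → Bool) → Set
EllipticConeOf q g S K = Σ (Vec V 4) λ e → Elliptic q e
  × IsCone q S e
  × (Σ V λ u → Σ V λ v → Independent (u ∷ v ∷ [])
       × (∀ x → InSpan (S ∷ e) x → InSpan g x → InSpan (u ∷ v ∷ []) x)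
       × (∀ x → InSpan (u ∷ v ∷ []) x → InSpan (S ∷ e) x × InSpan g x))
  × (∀ x → K x ≡ true → Vertex q g x × InSpan (S ∷ e) x)
  × (∀ x → Vertex q g x → InSpan (S ∷ e) x → K x ≡ true)

UniqueMaximalClique : (q : V → Bool) (g : Vec V 4) (P Q R T S : V) → Set
UniqueMaximalClique q g P Q R T S = Σ (V → Bool) λ K → MaximalClique q g K
  × K P ≡ true × K Q ≡ true × K R ≡ true × K T ≡ true
  × (∀ K′ → MaximalClique q g K′
       → K′ P ≡ true → K′ Q ≡ true → K′ R ≡ true → K′ T ≡ true
       → ∀ x → K′ x ≡ K x)
  × card K ≡ 8
  × EllipticConeOf q g S K

Conclusion : (q : V → Bool) (g : Vec V 4) (P Q R T : V) → Set
Conclusion q g P Q R T = Independent (P ∷ Q ∷ R ∷ T ∷ [])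
  × (Σ V λ S → PointOf g S × ConeOverConic q g P Q R T S × UniqueMaximalClique q g P Q R T S)

Conclusion-resp : ∀ {q g P Q R T P′ Q′ R′ T′} → P ≡ P′ → Q ≡ Q′ → R ≡ R′ → T ≡ T′ →
                  Conclusion q g P Q R T → Conclusion q g P′ Q′ R′ T′
Conclusion-resp refl refl refl refl c = c

module Frame (q : V → Bool) (isQ : IsQuadForm q) (ns : Nonsingular q) (g : Vec V 4) (gen : Generator q g)
             (frame : Vec V 7)
             (q-frame : ∀ w → q (comb w frame) ≡ q₇ w)
             (Π-frame : ∀ w → InΠ₇ w → InSpan g (comb w frame))
             (s₇-nonzero : comb s₇ frame ≢ 0v) where

  open QuadraticForm q isQ
  open Duality q isQ
  open Relations q g
  open ≡-Reasoning

  point : Coords → V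
  point w = comb w frame

  point-∔ : ∀ v w → point (v ∔ w) ≡ point v ⊕ point w
  point-∔ v w = comb-∔ v w frame

  β-point : ∀ v w → β (point v) (point w) ≡ polar₇ v w
  β-point v w = begin
    q (point v ⊕ point w) xor q (point v) xor q (point w)  ≡⟨ cong (λ u → q u xor q (point v) xor q (point w)) (point-∔ v w) ⟨
    q (point (v ∔ w)) xor q (point v) xor q (point w)      ≡⟨ cong₂ _xor_ (q-frame (v ∔ w)) (cong₂ _xor_ (q-frame v) (q-frame w)) ⟩
    polar₇ v w                                             ∎

  map-β-point : ∀ v (ws : Vec Coords k) → map (β (point v)) (map point ws) ≡ map (polar₇ v) ws
  map-β-point v []       = refl
  map-β-point v (w ∷ ws) = cong₂ _∷_ (β-point v w) (map-β-point v ws)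

  Π-isotropic : ∀ {x y} → InSpan g x → InSpan g y → β x y ≡ false
  Π-isotropic = generator-isotropic gen

  Π-point⁻ : ∀ {w} → InSpan g (point w) → InΠ₇ w
  Π-point⁻ {w} w∈Π = begin
    ACT-coords w                               ≡⟨ pairing₇ w ⟨
    map (polar₇ w) Ws₇                  ≡⟨ map-β-point w Ws₇ ⟨
    map (β (point w)) (map point Ws₇)   ≡⟨ cong₂ _∷_ (⊥W w₁₇ refl)
                                              (cong₂ _∷_ (⊥W w₂₇ refl) (cong₂ _∷_ (⊥W w₃₇ refl) refl)) ⟩
    zeros                               ∎
    where
    ⊥W : ∀ v → InΠ₇ v → β (point w) (point v) ≡ false
    ⊥W v v∈Π = Π-isotropic w∈Π (Π-frame v v∈Π)

  map-β-0vˡ : (xs : Vec V k) → map (β 0v) xs ≡ zeros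
  map-β-0vˡ []       = refl
  map-β-0vˡ (x ∷ xs) = cong₂ _∷_ (β-0vˡ x) (map-β-0vˡ xs)

  -- the radical of q₇ is spanned by s₇, and S ≠ 0v
  point-injective : ∀ {w} → point w ≡ 0v → w ≡ zeros
  point-injective {w} w≡0 with radical₇ w radical
    where
    radical : map (polar₇ w) units₇ ≡ zeros
    radical = begin
      map (polar₇ w) units₇                  ≡⟨ map-β-point w units₇ ⟨
      map (β (point w)) (map point units₇)   ≡⟨ cong (λ x → map (β x) (map point units₇)) w≡0 ⟩
      map (β 0v) (map point units₇)          ≡⟨ map-β-0vˡ (map point units₇) ⟩
      zeros                                  ∎
  ... | inj₁ w≡zeros = w≡zeros
  ... | inj₂ refl    = ⊥-elim (s₇-nonzero w≡0)

  point-injective′ : ∀ {v w} → point v ≡ point w → v ≡ w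
  point-injective′ {v} {w} e = ∔≡zeros⇒≡ v w (point-injective (begin
    point (v ∔ w)        ≡⟨ point-∔ v w ⟩
    point v ⊕ point w    ≡⟨ cong (_⊕ point w) e ⟩
    point w ⊕ point w    ≡⟨ ∔-self (point w) ⟩
    0v                   ∎))

  point-comb : (c : Vec Bool k) (ds : Vec Coords k) → lincomb c (map point ds) ≡ point (comb c ds)
  point-comb c ds = trans (lincomb≡comb c (map point ds)) (comb-map c ds frame)

  InSpan-points⁻ : {ds : Vec Coords k} → ∀ {x} → InSpan (map point ds) x → ∃ λ c → point (comb c ds) ≡ x
  InSpan-points⁻ {ds = ds} (c , e) = c , trans (sym (point-comb c ds)) e

  InSpan-points⁺ : {ds : Vec Coords k} → ∀ c → InSpan (map point ds) (point (comb c ds))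
  InSpan-points⁺ {ds = ds} c = c , point-comb c ds

  SubSpan-points : {ds : Vec Coords k} {ds′ : Vec Coords l} → SubSpan₇ ds ds′ → SubSpan (map point ds) (map point ds′)
  SubSpan-points {ds = ds} {ds′} sub x x∈ with InSpan-points⁻ x∈
  ... | c , refl with sub c
  ...   | c′ , e = subst (InSpan (map point ds′)) (cong point e) (InSpan-points⁺ c′)

  Independent-points : {ds : Vec Coords k} → Independent₇ ds → Independent (map point ds)
  Independent-points {ds = ds} indep c e = indep c (point-injective (trans (sym (point-comb c ds)) e))

  Independent-points⁻ : {ds : Vec Coords k} → Independent (map point ds) → Independent₇ ds
  Independent-points⁻ {ds = ds} indep c e = indep c (begin
    lincomb c (map point ds)  ≡⟨ point-comb c ds ⟩
    point (comb c ds)         ≡⟨ cong point e ⟩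
    point zeros               ≡⟨ comb-zeros frame ⟩
    0v                        ∎)

  NonsingularOn-points : {ds : Vec Coords k} → NonsingularOn₇ ds → NonsingularOn q (InSpan (map point ds))
  NonsingularOn-points {ds = ds} nonsing v v∈ v≢0 qv ⊥span with InSpan-points⁻ v∈
  ... | c , refl with nonsing c (λ e → v≢0 (trans (cong point e) (comb-zeros frame))) (trans (sym (q-frame (comb c ds))) qv)
  ...   | c′ , pairs with trans (sym pairs) (trans (sym (β-point (comb c ds) (comb c′ ds))) (⊥span _ (InSpan-points⁺ c′)))
  ...     | ()


  IsCone-points : {ds : Vec Coords k} → Independent₇ (s₇ ∷ ds) → IsCone q (point s₇) (map point ds)
  IsCone-points {ds = ds} indep = Independent-points indep , on-cone , singular
    where
    base-point : ∀ c → comb c ds ≢ zeros → PointOf (map point ds) (point (comb c ds))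
    base-point c y≢0 = (λ e → y≢0 (point-injective e)) , InSpan-points⁺ c
    on-cone : ∀ x → PointOf (map point (s₇ ∷ ds)) x → Sing q x → OnCone q (point s₇) (map point ds) x
    on-cone x (x≢0 , x∈) qx with InSpan-points⁻ {ds = s₇ ∷ ds} x∈
    ... | true ∷ c , refl with comb c ds ≟ᵛ zeros
    ...   | yes y≡0 = inj₁ (cong point (trans (cong (s₇ ∔_) y≡0) (∔-identityʳ s₇)))
    ...   | no y≢0  = inj₂ (point y , base-point c y≢0 , qy , inj₂ (point-∔ s₇ y))
      where
      y = comb c ds
      qy : q (point y) ≡ false
      qy = trans (q-frame y) (trans (sym (q₇-s₇ y)) (trans (sym (q-frame (s₇ ∔ y))) qx))
    on-cone x (x≢0 , x∈) qx | false ∷ c , refl with comb c ds ≟ᵛ zeros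
    ...   | yes y≡0 = ⊥-elim (x≢0 (trans (cong point (trans (∔-identityˡ _) y≡0)) (comb-zeros frame)))
    ...   | no y≢0  = inj₂ (point y , base-point c y≢0 , trans (cong q (sym y≡x)) qx , inj₁ y≡x)
      where
      y = comb c ds
      y≡x : point (zeros ∔ y) ≡ point y
      y≡x = cong point (∔-identityˡ y)
    singular : ∀ x → PointOf (map point (s₇ ∷ ds)) x → OnCone q (point s₇) (map point ds) x → Sing q x
    singular x _ (inj₁ refl)                           = q-frame s₇
    singular x _ (inj₂ (y , _ , qy , inj₁ refl))       = qy
    singular x _ (inj₂ (y , (_ , y∈) , qy , inj₂ refl)) with InSpan-points⁻ y∈
    ... | c , refl = begin
      q (point s₇ ⊕ point (comb c ds))  ≡⟨ cong q (point-∔ s₇ (comb c ds)) ⟨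
      q (point (s₇ ∔ comb c ds))        ≡⟨ q-frame (s₇ ∔ comb c ds) ⟩
      q₇ (s₇ ∔ comb c ds)               ≡⟨ q₇-s₇ (comb c ds) ⟩
      q₇ (comb c ds)                    ≡⟨ q-frame (comb c ds) ⟨
      q (point (comb c ds))             ≡⟨ qy ⟩
      false                             ∎

  Π-generator : Generator q (map point (s₇ ∷ Ws₇))
  Π-generator = Independent-points Π₇-basis-independent , λ x x∈ → proj₂ gen x (in-Π x∈)
    where
    in-Π : ∀ {x} → InSpan (map point (s₇ ∷ Ws₇)) x → InSpan g x
    in-Π {x} (c , refl) = subst (InSpan g) (sym (lincomb≡comb c _))
      (Subspace.comb∈ InSpan-subspace c (Π-frame s₇ refl ∷ Π-frame w₁₇ refl ∷ Π-frame w₂₇ refl ∷ Π-frame w₃₇ refl ∷ []))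

  -- Correcting Z by a combination of A, C, T makes it orthogonal to S, W₁, W₂, W₃, hence a vector of Π.
  point-onto : ∀ {Z} → β Z (point s₇) ≡ false → ∃ λ w → point w ≡ Z
  point-onto {Z} Z⊥S = from-Π-part (InSpan-points⁻ {ds = s₇ ∷ Ws₇} (generator-perp ns Π-generator Z′⊥))
    where
    m = map (β Z) (map point Ws₇)
    v : Coords
    v = m ++ zeros
    Z′ = Z ⊕ point v
    Z′⊥ : map (β Z′) (map point (s₇ ∷ Ws₇)) ≡ zeros
    Z′⊥ = cong₂ _∷_
      (trans (β-additiveˡ Z (point v) (point s₇)) (cong₂ _xor_ Z⊥S (trans (β-point v s₇) (s₇-radical v))))
      (begin
        map (β Z′) (map point Ws₇)                ≡⟨ map-β-additiveˡ Z (point v) (map point Ws₇) ⟩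
        m ∔ map (β (point v)) (map point Ws₇)     ≡⟨ cong (m ∔_) (trans (map-β-point v Ws₇) (pairing₇ v)) ⟩
        m ∔ m                                     ≡⟨ ∔-self m ⟩
        zeros                                     ∎)
    from-Π-part : (∃ λ r → point (comb r (s₇ ∷ Ws₇)) ≡ Z′) → ∃ λ w → point w ≡ Z
    from-Π-part (r , e) = comb r (s₇ ∷ Ws₇) ∔ v , (begin
      point (comb r (s₇ ∷ Ws₇) ∔ v)          ≡⟨ point-∔ (comb r (s₇ ∷ Ws₇)) v ⟩
      point (comb r (s₇ ∷ Ws₇)) ⊕ point v    ≡⟨ cong (_⊕ point v) e ⟩
      Z ⊕ point v ⊕ point v                  ≡⟨ ∔-cancelʳ Z (point v) ⟩
      Z                                      ∎)

  Vertex-point⁺ : ∀ {w} → q₇ w ≡ false → ¬ InΠ₇ w → Vertex q g (point w)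
  Vertex-point⁺ {w} qw w∉Π = (λ e → w∉Π (cong ACT-coords (point-injective e))) , trans (q-frame w) qw , w∉Π ∘ Π-point⁻

  Vertex-point⁻ : ∀ {w} → Vertex q g (point w) → q₇ w ≡ false × ¬ InΠ₇ w
  Vertex-point⁻ {w} (_ , qw , w∉Π) = trans (sym (q-frame w)) qw , w∉Π ∘ Π-frame w

  Joined-point⁻ : ∀ {v w} → Joined (point v) (point w) → Joined₇ (v ∔ w)
  Joined-point⁻ {v} {w} (inj₁ secant) = inj₁ (trans (sym (q-frame (v ∔ w))) (trans (cong q (point-∔ v w)) secant))
  Joined-point⁻ {v} {w} (inj₂ v⊕w∈Π) = inj₂ (Π-point⁻ (subst (InSpan g) (sym (point-∔ v w)) v⊕w∈Π))

  Joined-point⁺ : ∀ {v w} → Joined₇ (v ∔ w) → Joined (point v) (point w)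
  Joined-point⁺ {v} {w} (inj₁ secant) = inj₁ (trans (cong q (sym (point-∔ v w))) (trans (q-frame (v ∔ w)) secant))
  Joined-point⁺ {v} {w} (inj₂ v∔w∈Π) = inj₂ (subst (InSpan g) (point-∔ v w) (Π-frame (v ∔ w) v∔w∈Π))

  clique : List V
  clique = List.map point clique₇

  K : V → Bool
  K x = does (x ∈? clique)

  K-point : ∀ {w} → w ∈ clique₇ → K (point w) ≡ true
  K-point {w} w∈ = dec-true (point w ∈? clique) (∈-map⁺ point w∈)

  K-member : ∀ {x} → K x ≡ true → ∃ λ w → w ∈ clique₇ × x ≡ point w
  K-member {x} Kx = ∈-map⁻ point (decidable-stable (x ∈? clique) λ x∉ →
    contradiction (trans (sym Kx) (dec-false (x ∈? clique) x∉)) λ ())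

  K-vertex : ∀ {x} → K x ≡ true → Vertex q g x
  K-vertex {x} Kx with K-member {x} Kx
  ... | w , w∈ , refl = uncurry Vertex-point⁺ (ListAll.lookup clique₇-vertices w∈)

  K-clique : Clique q g K
  K-clique = (λ _ → K-vertex) , adjacent
    where
    adjacent : ∀ x y → K x ≡ true → K y ≡ true → x ≢ y → Adj q g x y
    adjacent x y Kx Ky x≢y with K-member {x} Kx | K-member {y} Ky
    ... | v , v∈ , refl | w , w∈ , refl =
      Joined⇒Adj gen (K-vertex Kx) (K-vertex Ky) x≢y (Joined-point⁺ (ListAll.lookup (ListAll.lookup clique₇-joined v∈) w∈))

  β-vanishes-by-sum : ∀ {x y z} → β (x ⊕ y) z ≡ false → β y z ≡ false → β x z ≡ false
  β-vanishes-by-sum {x} {y} {z} sum yz = begin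
    β x z              ≡⟨ xor-identityʳ (β x z) ⟨
    β x z xor false    ≡⟨ cong (β x z xor_) yz ⟨
    β x z xor β y z    ≡⟨ β-additiveˡ x y z ⟨
    β (x ⊕ y) z        ≡⟨ sum ⟩
    false              ∎

  joined-A-B⇒⊥S : ∀ {x} → Vertex q g x → Joined x (point a₇) → Joined x (point b₇) → β x (point s₇) ≡ false
  joined-A-B⇒⊥S {x} _ (inj₂ x⊕a∈Π) _ =
    β-vanishes-by-sum (Π-isotropic x⊕a∈Π (Π-frame s₇ refl)) (trans (β-point a₇ s₇) (s₇-radical a₇))
  joined-A-B⇒⊥S {x} _ (inj₁ _) (inj₂ x⊕b∈Π) =
    β-vanishes-by-sum (Π-isotropic x⊕b∈Π (Π-frame s₇ refl)) (trans (β-point b₇ s₇) (s₇-radical b₇))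
  joined-A-B⇒⊥S {x} (_ , qx , _) (inj₁ xa) (inj₁ xb) = begin
    β x (point s₇)                          ≡⟨ cong (β x) S≡A⊕B ⟩
    β x (point a₇ ⊕ point b₇)               ≡⟨ β-additiveʳ x (point a₇) (point b₇) ⟩
    β x (point a₇) xor β x (point b₇)       ≡⟨ cong₂ _xor_ (trans (β-singular qx (q-frame a₇)) xa) (trans (β-singular qx (q-frame b₇)) xb) ⟩
    false                                   ∎
    where
    S≡A⊕B : point s₇ ≡ point a₇ ⊕ point b₇
    S≡A⊕B = trans (sym (∔-cancelˡ (point a₇) (point s₇))) (cong (point a₇ ⊕_) (sym (point-∔ a₇ s₇)))

  joined⇒K-point : ∀ {w} → Vertex q g (point w) → Joined (point w) (point a₇) → Joined (point w) (point b₇) →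
                   Joined (point w) (point c₇) → Joined (point w) (point t₇) → K (point w) ≡ true
  joined⇒K-point {w} vw ja jb jc jt = K-point (clique₇-maximal w (proj₁ (Vertex-point⁻ {w} vw)) (proj₂ (Vertex-point⁻ {w} vw))
    (Joined-point⁻ ja) (Joined-point⁻ jb) (Joined-point⁻ jc) (Joined-point⁻ jt))

  joined⇒K : ∀ {x} → Vertex q g x →
             Joined x (point a₇) → Joined x (point b₇) → Joined x (point c₇) → Joined x (point t₇) → K x ≡ true
  joined⇒K {x} vx ja jb = from-point (point-onto (joined-A-B⇒⊥S vx ja jb)) vx ja jb
    where
    from-point : (∃ λ w → point w ≡ x) → Vertex q g x → Joined x (point a₇) → Joined x (point b₇) →
                 Joined x (point c₇) → Joined x (point t₇) → K x ≡ true
    from-point (w , refl) = joined⇒K-point {w}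

  clique⊆K : ∀ {K′} → Clique q g K′ →
             K′ (point a₇) ≡ true → K′ (point b₇) ≡ true → K′ (point c₇) ≡ true → K′ (point t₇) ≡ true →
             ∀ x → K′ x ≡ true → K x ≡ true
  clique⊆K K′-clique@(vertex , _) Ka Kb Kc Kt x Kx =
    joined⇒K (vertex x Kx) (joined Ka) (joined Kb) (joined Kc) (joined Kt)
    where
    joined : ∀ {y} → _ ≡ true → Joined x y
    joined Ky = clique-joined K′-clique Kx Ky

  K-A : K (point a₇) ≡ true
  K-A = K-point (here refl)

  K-B : K (point b₇) ≡ true
  K-B = K-point (there (here refl))

  K-C : K (point c₇) ≡ true
  K-C = K-point (there (there (here refl)))

  K-T : K (point t₇) ≡ true
  K-T = K-point (there (there (there (there (here refl)))))

  K-maximal : MaximalClique q g K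
  K-maximal = K-clique , λ K′ K′-clique K⊆K′ →
    clique⊆K K′-clique (K⊆K′ _ K-A) (K⊆K′ _ K-B) (K⊆K′ _ K-C) (K⊆K′ _ K-T)

  K-unique : ∀ K′ → MaximalClique q g K′ →
             K′ (point a₇) ≡ true → K′ (point b₇) ≡ true → K′ (point c₇) ≡ true → K′ (point t₇) ≡ true →
             ∀ x → K′ x ≡ K x
  K-unique K′ (K′-clique , K′-maximal) Ka Kb Kc Kt x =
    ⇔→≡ (mk⇔ (clique⊆K K′-clique Ka Kb Kc Kt x) (K′-maximal K K-clique (clique⊆K K′-clique Ka Kb Kc Kt) x))

  K-card : card K ≡ 8
  K-card = count-∈ (Unique-map⁺ point-injective′ clique₇-unique)

  cone-over-conic : ConeOverConic q g (point a₇) (point b₇) (point c₇) (point t₇) (point s₇)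
  cone-over-conic =
    map point conic₇ ,
    SubSpan-points conic-cone₇-in-ABCT ,
    (Independent-points (Independent₇-tail conic-cone₇-independent) , NonsingularOn-points conic₇-nonsingular) ,
    IsCone-points conic-cone₇-independent ,
    avoids-Π
    where
    avoids-Π : ∀ x → PointOf (map point conic₇) x → Sing q x → ¬ InSpan g x
    avoids-Π x (x≢0 , x∈) qx x∈Π with InSpan-points⁻ {ds = conic₇} x∈
    ... | c , refl = conic₇-avoids-Π c (λ e → x≢0 (trans (cong point e) (comb-zeros frame)))
                       (trans (sym (q-frame (comb c conic₇))) qx) (Π-point⁻ x∈Π)

  elliptic : Elliptic q (map point elliptic₇)
  elliptic = Independent-points (Independent₇-tail elliptic-cone₇-independent) ,
             NonsingularOn-points elliptic₇-nonsingular ,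
             no-line
    where
    no-line : ∀ u v → InSpan (map point elliptic₇) u → InSpan (map point elliptic₇) v → Independent (u ∷ v ∷ []) →
              ¬ (Sing q u × Sing q v × Sing q (u ⊕ v))
    no-line u v u∈ v∈ indep (qu , qv , quv) with InSpan-points⁻ {ds = elliptic₇} u∈ | InSpan-points⁻ {ds = elliptic₇} v∈
    ... | c , refl | c′ , refl = elliptic₇-no-line c c′ (Independent-points⁻ indep) (q₇c , q₇c′ , q₇c∔c′)
      where
      y = comb c elliptic₇
      y′ = comb c′ elliptic₇
      q₇c : q₇ y ≡ false
      q₇c = trans (sym (q-frame y)) qu
      q₇c′ : q₇ y′ ≡ false
      q₇c′ = trans (sym (q-frame y′)) qv
      q₇c∔c′ : q₇ (y ∔ y′) ≡ false
      q₇c∔c′ = trans (sym (q-frame (y ∔ y′))) (trans (cong q (point-∔ y y′)) quv)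

  cone∩Π⊆line : ∀ x → InSpan (map point (s₇ ∷ elliptic₇)) x → InSpan g x → InSpan (point s₇ ∷ point u₇ ∷ []) x
  cone∩Π⊆line x x∈ x∈Π with InSpan-points⁻ {ds = s₇ ∷ elliptic₇} x∈
  ... | c , refl with cone₇-meets-Π-in-line c (Π-point⁻ x∈Π)
  ...   | c′ , e = subst (InSpan (map point (s₇ ∷ u₇ ∷ []))) (cong point e) (InSpan-points⁺ c′)

  line⊆cone∩Π : ∀ x → InSpan (point s₇ ∷ point u₇ ∷ []) x → InSpan (map point (s₇ ∷ elliptic₇)) x × InSpan g x
  line⊆cone∩Π x x∈ with InSpan-points⁻ {ds = s₇ ∷ u₇ ∷ []} x∈
  ... | c , refl = SubSpan-points Π-line₇-in-cone _ x∈ , Π-frame _ (Π-line₇-in-Π c)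

  K⊆cone : ∀ x → K x ≡ true → Vertex q g x × InSpan (map point (s₇ ∷ elliptic₇)) x
  K⊆cone x Kx with K-member {x} Kx
  ... | w , w∈ , refl with ListAll.lookup clique₇-in-cone w∈
  ...   | c , e = K-vertex Kx , subst (InSpan (map point (s₇ ∷ elliptic₇))) (cong point e) (InSpan-points⁺ c)

  cone⊆K : ∀ x → Vertex q g x → InSpan (map point (s₇ ∷ elliptic₇)) x → K x ≡ true
  cone⊆K x vx x∈ with InSpan-points⁻ {ds = s₇ ∷ elliptic₇} x∈
  ... | c , refl = K-point (cone₇-vertices-in-clique c (proj₁ (Vertex-point⁻ {comb c (s₇ ∷ elliptic₇)} vx))
                                                     (proj₂ (Vertex-point⁻ {comb c (s₇ ∷ elliptic₇)} vx)))

  elliptic-cone : EllipticConeOf q g (point s₇) K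
  elliptic-cone =
    map point elliptic₇ , elliptic , IsCone-points elliptic-cone₇-independent ,
    (point s₇ , point u₇ , Independent-points Π-line₇-independent , cone∩Π⊆line , line⊆cone∩Π) ,
    K⊆cone , cone⊆K

  frame-conclusion : Conclusion q g (point a₇) (point b₇) (point c₇) (point t₇)
  frame-conclusion =
    Independent-points ABCT₇-independent ,
    point s₇ , (s₇-nonzero , Π-frame s₇ refl) , cone-over-conic ,
    K , K-maximal , K-A , K-B , K-C , K-T , K-unique , K-card , elliptic-cone

record Configuration (q : V → Bool) (g : Vec V 4) (A B C T : V) : Set where
  field
    A-vertex   : Vertex q g A
    B-vertex   : Vertex q g B
    C-vertex   : Vertex q g C
    T-vertex   : Vertex q g T
    A≢B        : A ≢ B
    A⊕B∈Π      : InSpan g (A ⊕ B)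
    A⊕C-secant : q (A ⊕ C) ≡ true
    B⊕C-secant : q (B ⊕ C) ≡ true
    T⊕A-secant : q (T ⊕ A) ≡ true
    T⊕B-secant : q (T ⊕ B) ≡ true
    T⊕C-secant : q (T ⊕ C) ≡ true

module Construction (q : V → Bool) (isQ : IsQuadForm q) (ns : Nonsingular q) (g : Vec V 4) (gen : Generator q g)
                    {A B C T : V} (conf : Configuration q g A B C T) where

  open Configuration conf
  open QuadraticForm q isQ
  open Duality q isQ
  open ≡-Reasoning

  S : V
  S = A ⊕ B

  ACT : Vec V 3
  ACT = A ∷ C ∷ T ∷ []

  Π-singular : ∀ {x} → InSpan g x → q x ≡ false
  Π-singular {x} = proj₂ gen x

  Π-isotropic : ∀ {x y} → InSpan g x → InSpan g y → β x y ≡ false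
  Π-isotropic = generator-isotropic gen

  qA : q A ≡ false
  qA = proj₁ (proj₂ A-vertex)
  qB : q B ≡ false
  qB = proj₁ (proj₂ B-vertex)
  qC : q C ≡ false
  qC = proj₁ (proj₂ C-vertex)
  qT : q T ≡ false
  qT = proj₁ (proj₂ T-vertex)

  β-A-C : β A C ≡ true
  β-A-C = trans (β-singular qA qC) A⊕C-secant
  β-A-T : β A T ≡ true
  β-A-T = trans (β-sym A T) (trans (β-singular qT qA) T⊕A-secant)
  β-C-T : β C T ≡ true
  β-C-T = trans (β-sym C T) (trans (β-singular qT qC) T⊕C-secant)

  β-A-S : β A S ≡ false
  β-A-S = trans (β-additiveʳ A A B) (cong₂ _xor_ (β-self A) (trans (β-singular qA qB) (Π-singular A⊕B∈Π)))
  β-C-S : β C S ≡ false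
  β-C-S = trans (β-additiveʳ C A B)
    (cong₂ _xor_ (trans (β-sym C A) β-A-C) (trans (β-sym C B) (trans (β-singular qB qC) B⊕C-secant)))
  β-T-S : β T S ≡ false
  β-T-S = trans (β-additiveʳ T A B)
    (cong₂ _xor_ (trans (β-singular qT qA) T⊕A-secant) (trans (β-singular qT qB) T⊕B-secant))

  ACT-singular : map q ACT ≡ zeros
  ACT-singular = cong₂ _∷_ qA (cong₂ _∷_ qC (cong₂ _∷_ qT refl))

  gram-ACT : gram ACT ≡ G₃
  gram-ACT = cong₂ _,_ (cong₂ _∷_ β-A-C (cong₂ _∷_ β-A-T refl)) (cong₂ _,_ (cong₂ _∷_ β-C-T refl) refl)

  ACT-avoids-Π : ∀ c → c ≢ zeros → ¬ InSpan g (comb c ACT)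
  ACT-avoids-Π c c≢0 c∈Π with triangle-singular-points c c≢0 singular
    where
    singular : quadratic zeros G₃ c ≡ false
    singular = begin
      quadratic zeros G₃ c                      ≡⟨ cong₂ (λ d G → quadratic d G c) ACT-singular gram-ACT ⟨
      quadratic (map q ACT) (gram ACT) c        ≡⟨ q-comb c ACT ⟨
      q (comb c ACT)                            ≡⟨ Π-singular c∈Π ⟩
      false                                     ∎
  ... | inj₁ refl        = proj₂ (proj₂ A-vertex) (subst (InSpan g) (comb-unit 0F ACT) c∈Π)
  ... | inj₂ (inj₁ refl) = proj₂ (proj₂ C-vertex) (subst (InSpan g) (comb-unit 1F ACT) c∈Π)
  ... | inj₂ (inj₂ refl) = proj₂ (proj₂ T-vertex) (subst (InSpan g) (comb-unit 2F ACT) c∈Π)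

  -- A combination of A, C, T orthogonal to all of Π would lie in Π, the polar of Π.
  ACT-separated : Separates (InSpan g) ACT
  ACT-separated c c≢0 = witness (decidable-stable (∃-Vec? (λ d → β v (comb d g) Bool.≟ true)) not-orthogonal)
    where
    v = comb c ACT
    not-orthogonal : ¬ ¬ (∃ λ d → β v (comb d g) ≡ true)
    not-orthogonal none = ACT-avoids-Π c c≢0 (generator-perp ns gen (dot-nondegenerate (map (β v) g) λ d →
      trans (dot-comm (map (β v) g) d) (trans (sym (β-combʳ d g v)) (¬-not λ e → none (d , e)))))
    witness : (∃ λ d → β v (comb d g) ≡ true) → ∃ λ w → InSpan g w × β v w ≡ true
    witness (d , e) = comb d g , (d , lincomb≡comb d g) , e

  module WithDual (W₁ W₂ W₃ : V) (W₁∈Π : InSpan g W₁) (W₂∈Π : InSpan g W₂) (W₃∈Π : InSpan g W₃)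
                  (dual : Dual ACT (W₁ ∷ W₂ ∷ W₃ ∷ [])) where

    Ws : Vec V 3
    Ws = W₁ ∷ W₂ ∷ W₃ ∷ []

    frame : Vec V 7
    frame = A ∷ C ∷ T ∷ S ∷ Ws

    dual-row : ∀ i → map (β (lookup ACT i)) Ws ≡ unit i
    dual-row i = trans (cong (λ x → map (β x) Ws) (sym (comb-unit i ACT))) (dual (unit i))

    gram-frame : gram frame ≡ G₇
    gram-frame =
      cong₂ _,_ (cong₂ _∷_ β-A-C (cong₂ _∷_ β-A-T (cong₂ _∷_ β-A-S (dual-row 0F)))) (
      cong₂ _,_ (cong₂ _∷_ β-C-T (cong₂ _∷_ β-C-S (dual-row 1F))) (
      cong₂ _,_ (cong₂ _∷_ β-T-S (dual-row 2F)) (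
      cong₂ _,_ (cong₂ _∷_ (Π-isotropic A⊕B∈Π W₁∈Π)
                  (cong₂ _∷_ (Π-isotropic A⊕B∈Π W₂∈Π) (cong₂ _∷_ (Π-isotropic A⊕B∈Π W₃∈Π) refl))) (
      cong₂ _,_ (cong₂ _∷_ (Π-isotropic W₁∈Π W₂∈Π) (cong₂ _∷_ (Π-isotropic W₁∈Π W₃∈Π) refl)) (
      cong₂ _,_ (cong₂ _∷_ (Π-isotropic W₂∈Π W₃∈Π) refl)
      refl)))))

    frame-singular : map q frame ≡ zeros
    frame-singular = cong₂ _∷_ qA (cong₂ _∷_ qC (cong₂ _∷_ qT (cong₂ _∷_ (Π-singular A⊕B∈Π)
      (cong₂ _∷_ (Π-singular W₁∈Π) (cong₂ _∷_ (Π-singular W₂∈Π) (cong₂ _∷_ (Π-singular W₃∈Π) refl))))))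

    q-frame : ∀ w → q (comb w frame) ≡ q₇ w
    q-frame w = begin
      q (comb w frame)                          ≡⟨ q-comb w frame ⟩
      quadratic (map q frame) (gram frame) w    ≡⟨ cong₂ (λ d G → quadratic d G w) frame-singular gram-frame ⟩
      quadratic zeros G₇ w                      ≡⟨ q₇-from-gram w ⟩
      q₇ w                                      ∎

    Π-frame : ∀ w → InΠ₇ w → InSpan g (comb w frame)
    Π-frame (false ∷ false ∷ false ∷ r) refl =
      subst (InSpan g) (sym (trans (∔-identityˡ _) (trans (∔-identityˡ _) (∔-identityˡ _))))
            (Subspace.comb∈ InSpan-subspace r (A⊕B∈Π ∷ W₁∈Π ∷ W₂∈Π ∷ W₃∈Π ∷ []))

    s₇-nonzero : comb s₇ frame ≢ 0v
    s₇-nonzero e = A≢B (∔≡zeros⇒≡ A B (trans (sym (comb-unit 3F frame)) e))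

    open Frame q isQ ns g gen frame q-frame Π-frame s₇-nonzero

    conclusion : Conclusion q g A B C T
    conclusion = Conclusion-resp (comb-unit 0F frame) B-point (comb-unit 1F frame) (comb-unit 2F frame) frame-conclusion
      where
      B-point : point b₇ ≡ B
      B-point = begin
        point (a₇ ∔ s₇)        ≡⟨ point-∔ a₇ s₇ ⟩
        point a₇ ⊕ point s₇    ≡⟨ cong₂ _⊕_ (comb-unit 0F frame) (comb-unit 3F frame) ⟩
        A ⊕ (A ⊕ B)            ≡⟨ ∔-cancelˡ A B ⟩
        B                      ∎

  conclusion : Conclusion q g A B C T
  conclusion = from-dual (dual-family InSpan-subspace ACT-separated)
    where
    from-dual : (∃ λ Ws → All (InSpan g) Ws × Dual ACT Ws) → Conclusion q g A B C T
    from-dual (W₁ ∷ W₂ ∷ W₃ ∷ [] , W₁∈Π ∷ W₂∈Π ∷ W₃∈Π ∷ [] , dual) =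
      WithDual.conclusion W₁ W₂ W₃ W₁∈Π W₂∈Π W₃∈Π dual

module Reorder (σ : ∀ {A : Set} → Vec A k → Vec A k)
               (σ-involutive : ∀ {A : Set} (xs : Vec A k) → σ (σ xs) ≡ xs)
               (σ-replicate : ∀ {A : Set} (a : A) → σ (replicate k a) ≡ replicate k a)
               (σ-lincomb : ∀ cs vs → lincomb (σ cs) (σ vs) ≡ lincomb cs vs) where

  InSpan-reorder : ∀ {vs x} → InSpan vs x → InSpan (σ vs) x
  InSpan-reorder {vs} (cs , e) = σ cs , trans (σ-lincomb cs vs) e

  Independent-reorder : ∀ {vs} → Independent vs → Independent (σ vs)
  Independent-reorder {vs} indep cs e = begin
    cs              ≡⟨ σ-involutive cs ⟨
    σ (σ cs)        ≡⟨ cong σ (indep (σ cs) (begin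
      lincomb (σ cs) vs              ≡⟨ σ-lincomb (σ cs) vs ⟨
      lincomb (σ (σ cs)) (σ vs)      ≡⟨ cong (λ c → lincomb c (σ vs)) (σ-involutive cs) ⟩
      lincomb cs (σ vs)              ≡⟨ e ⟩
      0v                             ∎)) ⟩
    σ (replicate _ false) ≡⟨ σ-replicate false ⟩
    replicate _ false     ∎
    where open ≡-Reasoning

swap₀₁ : {A : Set} → Vec A (suc (suc k)) → Vec A (suc (suc k))
swap₀₁ (x ∷ y ∷ xs) = y ∷ x ∷ xs

swap₁₂ : {A : Set} → Vec A (suc (suc (suc k))) → Vec A (suc (suc (suc k)))
swap₁₂ (x ∷ xs) = x ∷ swap₀₁ xs

swap₀₁-involutive : {A : Set} (xs : Vec A (suc (suc k))) → swap₀₁ (swap₀₁ xs) ≡ xs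
swap₀₁-involutive (x ∷ y ∷ xs) = refl

swap₁₂-involutive : {A : Set} (xs : Vec A (suc (suc (suc k)))) → swap₁₂ (swap₁₂ xs) ≡ xs
swap₁₂-involutive (x ∷ xs) = cong (x ∷_) (swap₀₁-involutive xs)

lincomb-swap₀₁ : (cs : Vec Bool (suc (suc k))) (vs : Vec V (suc (suc k))) → lincomb (swap₀₁ cs) (swap₀₁ vs) ≡ lincomb cs vs
lincomb-swap₀₁ (c ∷ d ∷ cs) (x ∷ y ∷ vs) = ∔-left-comm (d · y) (c · x) (lincomb cs vs)

lincomb-swap₁₂ : (cs : Vec Bool (suc (suc (suc k)))) (vs : Vec V (suc (suc (suc k)))) →
                 lincomb (swap₁₂ cs) (swap₁₂ vs) ≡ lincomb cs vs
lincomb-swap₁₂ (c ∷ cs) (x ∷ vs) = cong (c · x ⊕_) (lincomb-swap₀₁ cs vs)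

swap₀₁-replicate : {A : Set} (a : A) → swap₀₁ (replicate (suc (suc k)) a) ≡ replicate (suc (suc k)) a
swap₀₁-replicate a = refl

swap₁₂-replicate : {A : Set} (a : A) → swap₁₂ (replicate (suc (suc (suc k))) a) ≡ replicate (suc (suc (suc k))) a
swap₁₂-replicate a = refl

module Swap₀₁ = Reorder (swap₀₁ {k = 2}) swap₀₁-involutive swap₀₁-replicate lincomb-swap₀₁
module Swap₁₂ = Reorder (swap₁₂ {k = 1}) swap₁₂-involutive swap₁₂-replicate lincomb-swap₁₂

Conclusion-swap₀₁ : ∀ {q g P Q R T} → Conclusion q g P Q R T → Conclusion q g Q P R T
Conclusion-swap₀₁ (indep , S , S∈Π , (b , b⊆ , conic) , (K , K-max , KP , KQ , KR , KT , K-unique , rest)) =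
  Swap₀₁.Independent-reorder indep , S , S∈Π , (b , (λ x x∈ → Swap₀₁.InSpan-reorder (b⊆ x x∈)) , conic) ,
  (K , K-max , KQ , KP , KR , KT , (λ K′ m KQ′ KP′ → K-unique K′ m KP′ KQ′) , rest)

Conclusion-swap₁₂ : ∀ {q g P Q R T} → Conclusion q g P Q R T → Conclusion q g P R Q T
Conclusion-swap₁₂ (indep , S , S∈Π , (b , b⊆ , conic) , (K , K-max , KP , KQ , KR , KT , K-unique , rest)) =
  Swap₁₂.Independent-reorder indep , S , S∈Π , (b , (λ x x∈ → Swap₁₂.InSpan-reorder (b⊆ x x∈)) , conic) ,
  (K , K-max , KP , KR , KQ , KT , (λ K′ m KP′ KR′ KQ′ → K-unique K′ m KP′ KQ′ KR′) , rest)

module MixedTriangle (q : V → Bool) (g : Vec V 4) (gen : Generator q g) where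

  open Relations q g

  Joined-sym : ∀ {x y} → Joined x y → Joined y x
  Joined-sym {x} {y} = Data.Sum.map (subst (λ u → q u ≡ true) (∔-comm x y)) (subst (InSpan g) (∔-comm x y))

  Π-triangle : ∀ {x y z} → InSpan g (x ⊕ y) → InSpan g (x ⊕ z) → InSpan g (y ⊕ z)
  Π-triangle {x} {y} {z} xy∈Π xz∈Π = subst (InSpan g) sides (Subspace.⊕∈ InSpan-subspace xy∈Π xz∈Π)
    where
    sides : (x ⊕ y) ⊕ (x ⊕ z) ≡ y ⊕ z
    sides = trans (∔-interchange x y x z) (trans (cong (_⊕ (y ⊕ z)) (∔-self x)) (∔-identityˡ (y ⊕ z)))

  -- once x ⊕ y ∈ Π, a second side in Π would put the whole triangle in Π
  other-sides-secant : ∀ {x y z} → InSpan g (x ⊕ y) → ¬ (InSpan g (x ⊕ z) × InSpan g (y ⊕ z)) →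
                       Joined x z → Joined y z → q (x ⊕ z) ≡ true × q (y ⊕ z) ≡ true
  other-sides-secant xy∈Π not-both (inj₂ xz∈Π) _ = ⊥-elim (not-both (xz∈Π , Π-triangle xy∈Π xz∈Π))
  other-sides-secant {x} {y} xy∈Π not-both (inj₁ xz) (inj₂ yz∈Π) =
    ⊥-elim (not-both (Π-triangle (subst (InSpan g) (∔-comm x y) xy∈Π) yz∈Π , yz∈Π))
  other-sides-secant xy∈Π not-both (inj₁ xz) (inj₁ yz) = xz , yz

  Π-sym : ∀ {x y} → InSpan g (x ⊕ y) → InSpan g (y ⊕ x)
  Π-sym {x} {y} = subst (InSpan g) (∔-comm x y)

  secant∉Π : ∀ {x y} → Vertex q g x → Vertex q g y → Rel1 q g x y → ¬ InSpan g (x ⊕ y)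
  secant∉Π vx vy r x⊕y∈Π = contradiction (trans (sym (proj₂ (Rel1⇒secant vx vy r))) (proj₂ gen _ x⊕y∈Π)) λ ()

  configuration-from-Π-side : ∀ {A B C T} → Vertex q g A → Vertex q g B → Vertex q g C → Vertex q g T →
    A ≢ B → InSpan g (A ⊕ B) → ¬ (InSpan g (A ⊕ C) × InSpan g (B ⊕ C)) → Joined A C → Joined B C →
    Rel1 q g T A → Rel1 q g T B → Rel1 q g T C → Configuration q g A B C T
  configuration-from-Π-side vA vB vC vT A≢B A⊕B∈Π not-both AC BC TA TB TC = record
    { A-vertex   = vA
    ; B-vertex   = vB
    ; C-vertex   = vC
    ; T-vertex   = vT
    ; A≢B        = A≢B
    ; A⊕B∈Π      = A⊕B∈Π
    ; A⊕C-secant = proj₁ (other-sides-secant A⊕B∈Π not-both AC BC)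
    ; B⊕C-secant = proj₂ (other-sides-secant A⊕B∈Π not-both AC BC)
    ; T⊕A-secant = proj₂ (Rel1⇒secant vT vA TA)
    ; T⊕B-secant = proj₂ (Rel1⇒secant vT vB TB)
    ; T⊕C-secant = proj₂ (Rel1⇒secant vT vC TC)
    }

  mixed-configuration : ∀ {P Q R T} → Clique3 q g P Q R → MixedType q g P Q R → Vertex q g T →
                        Rel1 q g T P → Rel1 q g T Q → Rel1 q g T R →
                        Configuration q g P Q R T ⊎ Configuration q g P R Q T ⊎ Configuration q g Q R P T
  mixed-configuration {P} {Q} {R} {T} (PQ@(vP , vQ , P≢Q , _) , PR@(_ , vR , P≢R , _) , QR@(_ , _ , Q≢R , _))
                      (some-secant , some-in-Π) vT TP TQ TR = by-Π-side some-in-Π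
    where
    Π-singular : ∀ {x} → InSpan g x → q x ≡ false
    Π-singular {x} = proj₂ gen x
    not-all-in-Π : InSpan g (P ⊕ Q) → InSpan g (P ⊕ R) → InSpan g (Q ⊕ R) → ⊥
    not-all-in-Π PQ∈Π PR∈Π QR∈Π =
      [ flip (secant∉Π vP vQ) PQ∈Π , [ flip (secant∉Π vP vR) PR∈Π , flip (secant∉Π vQ vR) QR∈Π ]′ ]′ some-secant
    by-Π-side : Rel2 q g P Q ⊎ Rel2 q g P R ⊎ Rel2 q g Q R →
                Configuration q g P Q R T ⊎ Configuration q g P R Q T ⊎ Configuration q g Q R P T
    by-Π-side (inj₁ PQ₂) = inj₁ (configuration-from-Π-side vP vQ vR vT P≢Q PQ∈Π
      (λ (PR∈Π , QR∈Π) → not-all-in-Π PQ∈Π PR∈Π QR∈Π) (Adj⇒Joined PR) (Adj⇒Joined QR) TP TQ TR)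
      where PQ∈Π = Rel2⇒inΠ vP vQ PQ₂
    by-Π-side (inj₂ (inj₁ PR₂)) = inj₂ (inj₁ (configuration-from-Π-side vP vR vQ vT P≢R PR∈Π
      (λ (PQ∈Π , RQ∈Π) → not-all-in-Π PQ∈Π PR∈Π (Π-sym RQ∈Π))
      (Adj⇒Joined PQ) (Joined-sym (Adj⇒Joined QR)) TP TR TQ))
      where PR∈Π = Rel2⇒inΠ vP vR PR₂
    by-Π-side (inj₂ (inj₂ QR₂)) = inj₂ (inj₂ (configuration-from-Π-side vQ vR vP vT Q≢R QR∈Π
      (λ (QP∈Π , RP∈Π) → not-all-in-Π (Π-sym QP∈Π) (Π-sym RP∈Π) QR∈Π)
      (Joined-sym (Adj⇒Joined PQ)) (Joined-sym (Adj⇒Joined PR)) TQ TR TP))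
      where QR∈Π = Rel2⇒inΠ vQ vR QR₂

lemma4p13 : (q : V → Bool) → IsQuadForm q → Nonsingular q
    → (g : Vec V 4) → Generator q g
    → (P Q R T : V)
    → Clique3 q g P Q R → MixedType q g P Q R
    → Vertex q g T → ¬ InSpan (P ∷ Q ∷ R ∷ []) T
    → Rel1 q g T P → Rel1 q g T Q → Rel1 q g T R
    → Independent (P ∷ Q ∷ R ∷ T ∷ [])
      × (Σ V λ S → PointOf g S
        × (Σ (Vec V 3) λ b → SubSpan (S ∷ b) (P ∷ Q ∷ R ∷ T ∷ [])
             × NondegConic q b
             × IsCone q S b
             × (∀ x → PointOf b x → Sing q x → ¬ InSpan g x))
        × (Σ (V → Bool) λ K → MaximalClique q g K
             × K P ≡ true × K Q ≡ true × K R ≡ true × K T ≡ true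
             × (∀ K′ → MaximalClique q g K′
                  → K′ P ≡ true → K′ Q ≡ true → K′ R ≡ true → K′ T ≡ true
                  → ∀ x → K′ x ≡ K x)
             × card K ≡ 8
             × (Σ (Vec V 4) λ e → Elliptic q e
                  × IsCone q S e
                  × (Σ V λ u → Σ V λ v → Independent (u ∷ v ∷ [])
                       × (∀ x → InSpan (S ∷ e) x → InSpan g x → InSpan (u ∷ v ∷ []) x)
                       × (∀ x → InSpan (u ∷ v ∷ []) x → InSpan (S ∷ e) x × InSpan g x))
                  × (∀ x → K x ≡ true → Vertex q g x × InSpan (S ∷ e) x)
                  × (∀ x → Vertex q g x → InSpan (S ∷ e) x → K x ≡ true))))
lemma4p13 q isQ ns g gen P Q R T clique mixed T-vertex _ TP TQ TR =
  by-configuration (MixedTriangle.mixed-configuration q g gen clique mixed T-vertex TP TQ TR)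
  where
  conclusion : ∀ {A B C} → Configuration q g A B C T → Conclusion q g A B C T
  conclusion = Construction.conclusion q isQ ns g gen
  by-configuration : Configuration q g P Q R T ⊎ Configuration q g P R Q T ⊎ Configuration q g Q R P T →
                     Conclusion q g P Q R T
  by-configuration (inj₁ PQ-in-Π)        = conclusion PQ-in-Π
  by-configuration (inj₂ (inj₁ PR-in-Π)) = Conclusion-swap₁₂ (conclusion PR-in-Π)
  by-configuration (inj₂ (inj₂ QR-in-Π)) = Conclusion-swap₀₁ (Conclusion-swap₁₂ (conclusion QR-in-Π))
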